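{- Let $n\ge1$, let $m=(m_0,\dots,m_n)$ be a sequence of non-negative integers giving the labeling of $\mathcal{G}^z_n$, and weight the edges of $\mathcal{G}^z_n$ as follows: $a_0$ is the left edge of $T_1$; for $1\le k\le n-1$, $a_k$ is the edge shared by $T_k$ and $T_{k+1}$; for odd $k$, $b_k$ is the bottom edge and $c_k$ the right edge of $T_k$; for even $k$, $b_k$ is the left edge and $c_k$ the top edge of $T_k$; $a_n$ is the remaining edge of $T_n$. Define \[ X = U_{m_0}(b_1)\,T_{m_0,m_1}(a_0c_1)\,U_{m_1}(a_1)\prod_{k=2}^n W_{m_{k-1}}(b_k)\,T_{m_{k-1},m_k}(b_k^{ -1}c_k)\,U_{m_k}(a_k), \] the product taken in left-to-right order of increasing $k$. Then for all $1\le i\le m_0+1$, $1\le j\le m_n+1$, $X_{ij}$ equals the sum of $\mathrm{wt}(\omega)$ over all mixed dimer covers $\omega$ of $\mathcal{G}^z_n$ with labeling $(m_0+1-i,m_1,\dots,m_{n-1},m_n+1-j)$, where $\mathrm{wt}(\omega)=\prod_e(\text{weight of }e)^{\omega(e)}$.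
   Context: Mixed dimer covers: for a finite graph $\mathcal{G}=(V,E)$ and $\mathbf{n}\colon V\to\mathbb{N}$, a mixed dimer cover is $\omega\colon E\to\mathbb{N}$ with $\sum_{e\ni v}\omega(e)=\mathbf{n}(v)$ for all $v$. Zigzag snake graph $\mathcal{G}^z_n$: union of unit squares $T_1,\dots,T_n$ with $T_{2j+1}$ having lower-left corner $(j,j)$ and $T_{2j}$ having lower-left corner $(j-1,j)$; vertices are lattice points on the tiles, edges unit sides. Vertices are partitioned into pairs $P_0,\dots,P_n$: for $1\le k\le n$, if $k=2j+1$ then $P_{k-1}=\{(j,j),(j+1,j)\}$, if $k=2j$ then $P_{k-1}=\{(j-1,j),(j-1,j+1)\}$; $P_n$ is the remaining two vertices; the labeling $(x_0,\dots,x_n)$ gives both vertices of $P_i$ the value $x_i$. $U_N(t)$ is the $(N+1)\times(N+1)$ matrix with $(i,j)$-entry $t^{N+2-i-j}$ if $i+j\le N+2$ and $0$ otherwise; $T_{a,b}(t)$ is the $(a+1)\times(b+1)$ matrix with $(i,i)$-entry $t^{i-1}$ and other entries $0$; $W_N(t)$ is the $(N+1)\times(N+1)$ matrix whose $(i,N+2-i)$-entry is $t^N$ for each $i$ and all other entries $0$. -}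

module Defs where

open import Data.Nat using (ℕ; zero; suc; _+_; _∸_; _≤_; _≡ᵇ_; _≤ᵇ_; ⌊_/2⌋)
open import Data.Bool using (Bool; true; false; if_then_else_; _∧_; _∨_)
open import Data.Product using (Σ; _×_; _,_; proj₁; proj₂)
open import Data.Fin using (Fin; toℕ)
open import Data.Vec using (Vec; lookup; tabulate; _++_)
open import Data.List using (List; []; _∷_; map; upTo; foldr)
open import Data.List.Membership.Propositional using (_∈_)
open import Algebra.Bundles using (CommutativeRing)

Point : Set
Point = ℕ × ℕ

_==P_ : Point → Point → Bool
(x , y) ==P (x' , y') = (x ≡ᵇ x') ∧ (y ≡ᵇ y')

odd : ℕ → Bool
odd zero = false
odd (suc k) = if odd k then false else true

ll : ℕ → Point
ll k = if odd k then (⌊ k /2⌋ , ⌊ k /2⌋) else (⌊ k /2⌋ ∸ 1 , ⌊ k /2⌋)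

leftS rightS bottomS topS : ℕ → Point × Point
leftS   k = (proj₁ (ll k) , proj₂ (ll k)) , (proj₁ (ll k) , suc (proj₂ (ll k)))
rightS  k = (suc (proj₁ (ll k)) , proj₂ (ll k)) , (suc (proj₁ (ll k)) , suc (proj₂ (ll k)))
bottomS k = (proj₁ (ll k) , proj₂ (ll k)) , (suc (proj₁ (ll k)) , proj₂ (ll k))
topS    k = (proj₁ (ll k) , suc (proj₂ (ll k))) , (suc (proj₁ (ll k)) , suc (proj₂ (ll k)))

corners : ℕ → List Point
corners k = let (x , y) = ll k in (x , y) ∷ (suc x , y) ∷ (x , suc y) ∷ (suc x , suc y) ∷ []

IsVertex : ℕ → Point → Set
IsVertex n v = Σ ℕ λ k → 1 ≤ k × k ≤ n × v ∈ corners k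

data Lab : Set where
  a b c : ℕ → Lab

-- endpoints of each named edge, following the paper's description:
--  a_0 = left edge of T_1;
--  a_k (1 ≤ k ≤ n-1) = edge shared by T_k and T_{k+1}
--      (= top of T_k for k odd, right of T_k for k even);
--  a_n = remaining edge of T_n (again top of T_n if n odd, right if n even);
--  b_k = bottom (k odd) / left (k even) of T_k;
--  c_k = right (k odd) / top (k even) of T_k.
ends : Lab → Point × Point
ends (a zero)    = leftS 1
ends (a (suc k)) = if odd (suc k) then topS (suc k) else rightS (suc k)
ends (b k)       = if odd k then bottomS k else leftS k
ends (c k)       = if odd k then rightS k else topS k

E : ℕ → ℕ
E n = suc n + (n + n)

edges : (n : ℕ) → Vec Lab (E n)
edges n = tabulate {suc n} (λ i → a (toℕ i))
       ++ (tabulate {n} (λ i → b (suc (toℕ i)))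
       ++  tabulate {n} (λ i → c (suc (toℕ i))))

incident : Point → Lab → Bool
incident v e = (proj₁ (ends e) ==P v) ∨ (proj₂ (ends e) ==P v)

sumℕ : (k : ℕ) → (Fin k → ℕ) → ℕ
sumℕ zero    f = 0
sumℕ (suc k) f = f Fin.zero + sumℕ k (λ i → f (Fin.suc i))

deg : (n : ℕ) → Vec ℕ (E n) → Point → ℕ
deg n ω v = sumℕ (E n) (λ e → if incident v (lookup (edges n) e) then lookup ω e else 0)

-- the pairs P_{k-1} (1 ≤ k ≤ n):
--   k = 2j+1 ↦ {(j,j),(j+1,j)},  k = 2j ↦ {(j-1,j),(j-1,j+1)}
pairP : ℕ → List Point
pairP k = if odd k
  then (⌊ k /2⌋ , ⌊ k /2⌋) ∷ (suc ⌊ k /2⌋ , ⌊ k /2⌋) ∷ []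
  else (⌊ k /2⌋ ∸ 1 , ⌊ k /2⌋) ∷ (⌊ k /2⌋ ∸ 1 , suc ⌊ k /2⌋) ∷ []

memP : Point → List Point → Bool
memP v []       = false
memP v (w ∷ ws) = (v ==P w) ∨ memP v ws

-- the vertex labeling induced by (x_0,…,x_n): value x_{k-1} on P_{k-1}
-- for 1 ≤ k ≤ n, and x_n on the remaining vertices (= P_n)
label : (n : ℕ) → (ℕ → ℕ) → Point → ℕ
label n x v = foldr (λ k r → if memP v (pairP k) then x (k ∸ 1) else r)
                    (x n) (map suc (upTo n))

IsCover : (n : ℕ) → (Point → ℕ) → Vec ℕ (E n) → Set
IsCover n 𝐧 ω = (v : Point) → IsVertex n v → deg n ω v ≡ 𝐧 v
  where open import Relation.Binary.PropositionalEquality using (_≡_)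

-- the labeling (m_0 - i', m_1, …, m_{n-1}, m_n - j') (0-based i', j';
-- i.e. m_0+1-i, m_n+1-j for 1-based i, j)
modLab : (n : ℕ) → (ℕ → ℕ) → ℕ → ℕ → ℕ → ℕ
modLab n m i j k =
  if k ≡ᵇ 0 then m 0 ∸ i else if k ≡ᵇ n then m n ∸ j else m k

module RingDefs {ℓ₁ ℓ₂} (R : CommutativeRing ℓ₁ ℓ₂) where
  open CommutativeRing R renaming (_+_ to _+R_; _*_ to _*R_)

  pow : Carrier → ℕ → Carrier
  pow t zero    = 1#
  pow t (suc k) = t *R pow t k

  sumR : (k : ℕ) → (Fin k → Carrier) → Carrier
  sumR zero    f = 0#
  sumR (suc k) f = f Fin.zero +R sumR k (λ i → f (Fin.suc i))

  prodR : (k : ℕ) → (Fin k → Carrier) → Carrier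
  prodR zero    f = 1#
  prodR (suc k) f = f Fin.zero *R prodR k (λ i → f (Fin.suc i))

  sumList : List Carrier → Carrier
  sumList = foldr _+R_ 0#

  Mat : ℕ → ℕ → Set ℓ₁
  Mat r s = Fin r → Fin s → Carrier

  _⊗_ : ∀ {r s t} → Mat r s → Mat s t → Mat r t
  (M ⊗ N) i k = sumR _ (λ j → M i j *R N j k)

  idM : ∀ {r} → Mat r r
  idM i j = if toℕ i ≡ᵇ toℕ j then 1# else 0#

  -- 0-based indices: (i+1, j+1)-entry of the paper's matrices
  -- U_N(t): t^{N-i-j} if i+j ≤ N, else 0
  U : (N : ℕ) → Carrier → Mat (suc N) (suc N)
  U N t i j = if (toℕ i + toℕ j) ≤ᵇ N then pow t (N ∸ (toℕ i + toℕ j)) else 0#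

  Tm : (p q : ℕ) → Carrier → Mat (suc p) (suc q)
  Tm p q t i j = if toℕ i ≡ᵇ toℕ j then pow t (toℕ i) else 0#

  W : (N : ℕ) → Carrier → Mat (suc N) (suc N)
  W N t i j = if (toℕ i + toℕ j) ≡ᵇ N then pow t N else 0#

  -- Weights: A k = a_k, B k = b_k, C k = c_k, Binv k = b_k^{-1}.
  -- X_n = U_{m0}(b1) T_{m0,m1}(a0 c1) U_{m1}(a1) ∏_{k=2}^n W(b_k) T(b_k^{-1} c_k) U(a_k)
  X : (m : ℕ → ℕ) (A B C Binv : ℕ → Carrier) → (k : ℕ) → Mat (suc (m 0)) (suc (m k))
  X m A B C Binv zero = idM   -- unused (n ≥ 1)
  X m A B C Binv (suc zero) =
    (U (m 0) (B 1) ⊗ Tm (m 0) (m 1) (A 0 *R C 1)) ⊗ U (m 1) (A 1)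
  X m A B C Binv (suc (suc k)) =
    X m A B C Binv (suc k) ⊗
      ((W (m (suc k)) (B (suc (suc k)))
        ⊗ Tm (m (suc k)) (m (suc (suc k))) (Binv (suc (suc k)) *R C (suc (suc k))))
        ⊗ U (m (suc (suc k))) (A (suc (suc k))))

  weight : (A B C : ℕ → Carrier) → Lab → Carrier
  weight A B C (a k) = A k
  weight A B C (b k) = B k
  weight A B C (c k) = C k

  wt : (n : ℕ) (A B C : ℕ → Carrier) → Vec ℕ (E n) → Carrier
  wt n A B C ω = prodR (E n) (λ e → pow (weight A B C (lookup (edges n) e)) (lookup ω e))

{-# OPTIONS --safe #-}

-- A cover of G^z_{n+1} is a cover μ of G^z_n followed by the multiplicities (β, γ, α) of the edges
-- b_{n+1}, c_{n+1}, a_{n+1} of the last tile.  The equations at the two new vertices say β + γ = x_n and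
-- γ + α = x_{n+1}, and the remaining ones are those of G^z_n with the label of P_n lowered to γ = x_n - β.
-- Grouping the covers of G^z_{n+1} with labeling (m₀ - i, m₁, …, m_{n+1} - j) by β = q therefore gives
-- the covers of G^z_n with labeling (m₀ - i, …, m_n - q), each multiplied by the monomial
-- b^q c^(m_n - q) a^(m_{n+1} - (m_n - q) - j), and this monomial is the (q, j) entry of W(b) T(b⁻¹c) U(a)
-- because b^(m_n) (b⁻¹)^(m_n - q) = b^q.  By induction the sum over q is the matrix product.  For G^z_1 the
-- same decomposition over G^z_0, the edge a₀ alone, leaves exactly one cover for each multiplicity s of c₁
-- (which equals that of a₀), and its weight is the s-th term of the (i, j) entry of U(b₁) T(a₀c₁) U(a₁).
module Submission where

open import Defs
open import Data.Nat using (ℕ; suc; _≤_)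
open import Data.Bool using (T; if_then_else_; true; false)
open import Data.Fin using (Fin; toℕ)
open import Data.Vec using (Vec)
open import Data.List using (List; map)
open import Data.List.Membership.Propositional using (_∈_)
open import Data.List.Relation.Unary.Unique.Propositional using (Unique)
open import Data.Product using (_,_)
open import Function.Bundles using (_⇔_)
open import Algebra.Bundles using (CommutativeRing)
open import Relation.Nullary using (¬_)
import Relation.Binary.PropositionalEquality as ≡
open ≡ using (_≡_; _≢_)

if-true : ∀ {ℓ} {A : Set ℓ} {b} {x y : A} → T b → (if b then x else y) ≡ x
if-true {b = true} _ = ≡.refl

if-false : ∀ {ℓ} {A : Set ℓ} {b} {x y : A} → ¬ T b → (if b then x else y) ≡ y
if-false {b = false} _  = ≡.refl
if-false {b = true}  ¬T with () ← ¬T _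

module Enumerations where

  open import Data.List using ([]; _∷_; filter)
  open import Data.List.Properties using (map-∘; map-id-local)
  import Data.List.Relation.Unary.All as All
  open import Data.List.Relation.Unary.Any using (here; there)
  open import Data.List.Membership.Propositional.Properties
    using (∈-filter⁺; ∈-filter⁻; ∈-map⁺; ∈-map⁻)
  import Data.List.Relation.Unary.Unique.Propositional.Properties as Uniqueₚ
  open import Data.Product using (_×_; proj₁; proj₂)
  open import Data.Empty using (⊥; ⊥-elim)
  open import Relation.Unary using (Decidable)
  open import Function using (mk⇔; Equivalence)
  open import Function.Properties.Equivalence using () renaming (trans to ⇔-trans)
  open ≡ using (refl; cong₂; subst; sym; trans)

  infix 4 _Enumerates_

  _Enumerates_ : {A : Set} → List A → (A → Set) → Set
  L Enumerates P = Unique L × (∀ u → u ∈ L ⇔ P u)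

  module _ {A : Set} where

    ∉⇒≡[] : {L : List A} → (∀ {u} → u ∈ L → ⊥) → L ≡ []
    ∉⇒≡[] {[]}    _  = refl
    ∉⇒≡[] {_ ∷ _} ∉L = ⊥-elim (∉L (here refl))

    module _ {L : List A} {P : A → Set} (enum : L Enumerates P) where

      private
        member : ∀ {u} → u ∈ L → P u
        member {u} = Equivalence.to (proj₂ enum u)
        complete : ∀ {u} → P u → u ∈ L
        complete {u} = Equivalence.from (proj₂ enum u)

      Enumerates-⇔ : {Q : A → Set} → (∀ u → P u ⇔ Q u) → L Enumerates Q
      Enumerates-⇔ P⇔Q = proj₁ enum , λ u → ⇔-trans (proj₂ enum u) (P⇔Q u)

      Enumerates-filter : {Q : A → Set} (Q? : Decidable Q) → filter Q? L Enumerates (λ u → P u × Q u)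
      Enumerates-filter Q? = Uniqueₚ.filter⁺ Q? (proj₁ enum) , λ u → mk⇔
        (λ u∈ → let u∈L , Qu = ∈-filter⁻ Q? u∈ in member u∈L , Qu)
        (λ (Pu , Qu) → ∈-filter⁺ Q? (complete Pu) Qu)

      Enumerates-empty : (∀ u → ¬ P u) → L ≡ []
      Enumerates-empty ¬P = ∉⇒≡[] (λ u∈L → ¬P _ (member u∈L))

    Enumerates-singleton : ∀ {u : A} {L} → L Enumerates (_≡ u) → L ≡ u ∷ []
    Enumerates-singleton {u} {[]}    (_ , mem) with () ← Equivalence.from (mem u) refl
    Enumerates-singleton {u} {v ∷ L} (uniq , mem) = cong₂ _∷_ v≡u (∉⇒≡[] v∉L)
      where
      v≡u : v ≡ u
      v≡u = Equivalence.to (mem v) (here refl)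
      v∉L : ∀ {w} → w ∈ L → ⊥
      v∉L w∈L = Uniqueₚ.Unique[x∷xs]⇒x∉xs uniq
        (subst (_∈ L) (trans (Equivalence.to (mem _) (there w∈L)) (sym v≡u)) w∈L)

    module _ {B : Set} (g : A → B) (h : B → A) (h∘g : ∀ u → h (g u) ≡ u)
             {L : List B} {P : B → Set} (enum : L Enumerates P) (g∘h : ∀ v → P v → g (h v) ≡ v) where

      private
        holds : ∀ {v} → v ∈ L → P v
        holds = Equivalence.to (proj₂ enum _)

      map-section : map g (map h L) ≡ L
      map-section = trans (sym (map-∘ L)) (map-id-local (All.tabulate (λ v∈L → g∘h _ (holds v∈L))))

      Enumerates-pullback : map h L Enumerates (λ u → P (g u))
      Enumerates-pullback =
        Uniqueₚ.map⁻ (subst Unique (sym map-section) (proj₁ enum)) , λ u → mk⇔ (pulled u) (pushed u)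
        where
        pulled : ∀ u → u ∈ map h L → P (g u)
        pulled u u∈ with v , v∈L , refl ← ∈-map⁻ h u∈ = subst P (sym (g∘h v (holds v∈L))) (holds v∈L)
        pushed : ∀ u → P (g u) → u ∈ map h L
        pushed u Pgu = subst (_∈ map h L) (h∘g u) (∈-map⁺ h (Equivalence.from (proj₂ enum (g u)) Pgu))

module Covers where

  open import Data.Nat using (zero; _+_; _∸_; _<_; _≡ᵇ_; s≤s)
  open import Data.Nat.Properties
    using (≤-refl; n≤1+n; n<1+n; m<n⇒m<1+n; m<1+n⇒m<n∨m≡n; <⇒≢; +-comm; +-assoc; +-identityʳ;
           +-cancelʳ-≡; m≤m+n; m+n∸m≡n; ∸-+-assoc; m+[n∸m]≡n; m+n≤o⇒m≤o∸n; m≤o∸n⇒m+n≤o; ≡ᵇ⇒≡; ≡⇒≡ᵇ)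
  open import Data.Vec using ([]; _∷_; _∷ʳ_; init; last; initLast)
  open import Data.Vec.Properties using (init-∷ʳ; last-∷ʳ)
  open import Data.Product using (_×_; proj₂)
  open import Data.Sum using (inj₁; inj₂)
  open import Function using (_∘_; mk⇔; Equivalence)
  open ≡ using (refl; cong; cong₂; subst; sym; trans; module ≡-Reasoning)

  open Enumerations

  get : ∀ {k} → Vec ℕ k → ℕ → ℕ
  get []       t       = 0
  get (e ∷ v)  zero    = e
  get (e ∷ v)  (suc t) = get v t

  get-≥ : ∀ {k} (v : Vec ℕ k) {t} → k ≤ t → get v t ≡ 0
  get-≥ []      _         = refl
  get-≥ (e ∷ v) (s≤s k≤t) = get-≥ v k≤t

  get-∷ʳ-< : ∀ {k} (v : Vec ℕ k) {e t} → t < k → get (v ∷ʳ e) t ≡ get v t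
  get-∷ʳ-< (d ∷ v) {t = zero}  _         = refl
  get-∷ʳ-< (d ∷ v) {t = suc t} (s≤s t<k) = get-∷ʳ-< v t<k

  get-∷ʳ-last : ∀ {k} (v : Vec ℕ k) {e} → get (v ∷ʳ e) k ≡ e
  get-∷ʳ-last []      = refl
  get-∷ʳ-last (d ∷ v) = get-∷ʳ-last v

  init∷ʳlast : ∀ {k} (v : Vec ℕ (suc k)) → init v ∷ʳ last v ≡ v
  init∷ʳlast v = sym (proj₂ (proj₂ (initLast v)))

  -- A cover ω of G^z_n is recorded as as = (ω a₀, …, ω aₙ), bs = (ω b₁, …, ω bₙ) and
  -- cs = (ω c₁, …, ω cₙ).
  record Mult (n : ℕ) : Set where
    constructor mult
    field
      as : Vec ℕ (suc n)
      bs cs : Vec ℕ n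
  open Mult public

  -- The multiplicities (β , γ , α) of b_{n+1}, c_{n+1}, a_{n+1}, the edges added with the tile T_{n+1}.
  Tile : Set
  Tile = ℕ × ℕ × ℕ

  _▷_ : ∀ {n} → Mult n → Tile → Mult (suc n)
  mult as bs cs ▷ (β , γ , α) = mult (as ∷ʳ α) (bs ∷ʳ β) (cs ∷ʳ γ)

  -- G^z_n has spine vertices u₀, …, u_{n+1}, joined in turn by a₀, …, aₙ, and outer vertices
  -- w₀, …, w_{n-1}, where b_{t+1} joins u_t to w_t and c_{t+1} joins w_t to u_{t+2}.  These are the
  -- degrees of u_t and w_t (get is 0 outside the vector).
  spineDeg : ∀ {n} → Mult n → ℕ → ℕ
  spineDeg (mult as bs cs) t = get as t + get (0 ∷ as) t + (get bs t + get (0 ∷ 0 ∷ cs) t)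

  outerDeg : ∀ {n} → Mult n → ℕ → ℕ
  outerDeg (mult as bs cs) t = get bs t + get cs t

  module _ {n} (μ : Mult n) (β γ α : ℕ) where
    open ≡-Reasoning

    spineDeg-▷-< : ∀ {t} → t < n → spineDeg (μ ▷ (β , γ , α)) t ≡ spineDeg μ t
    spineDeg-▷-< {t} t<n = cong₂ _+_
      (cong₂ _+_ (get-∷ʳ-< (as μ) t<1+n) (get-∷ʳ-< (0 ∷ as μ) t<2+n))
      (cong₂ _+_ (get-∷ʳ-< (bs μ) t<n) (get-∷ʳ-< (0 ∷ 0 ∷ cs μ) t<2+n))
      where
      t<1+n : t < suc n
      t<1+n = m<n⇒m<1+n t<n
      t<2+n : t < suc (suc n)
      t<2+n = m<n⇒m<1+n t<1+n

    spineDeg-▷-n : spineDeg (μ ▷ (β , γ , α)) n ≡ spineDeg μ n + β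
    spineDeg-▷-n = begin
      spineDeg (μ ▷ (β , γ , α)) n
        ≡⟨ cong₂ _+_
             (cong₂ _+_ (get-∷ʳ-< (as μ) (n<1+n n)) (get-∷ʳ-< (0 ∷ as μ) (m<n⇒m<1+n (n<1+n n))))
             (cong₂ _+_ (get-∷ʳ-last (bs μ)) (get-∷ʳ-< (0 ∷ 0 ∷ cs μ) (m<n⇒m<1+n (n<1+n n)))) ⟩
      A + (β + C)          ≡⟨ cong (A +_) (+-comm β C) ⟩
      A + (C + β)          ≡⟨ sym (+-assoc A C β) ⟩
      A + C + β            ≡⟨ cong (λ z → A + (z + C) + β) (sym (get-≥ (bs μ) ≤-refl)) ⟩
      spineDeg μ n + β     ∎
      where
      A C : ℕ
      A = get (as μ) n + get (0 ∷ as μ) n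
      C = get (0 ∷ 0 ∷ cs μ) n

    spineDeg-▷-1+n : spineDeg (μ ▷ (β , γ , α)) (suc n) ≡ spineDeg μ (suc n) + α
    spineDeg-▷-1+n = begin
      spineDeg (μ ▷ (β , γ , α)) (suc n)
        ≡⟨ cong₂ _+_
             (cong₂ _+_ (get-∷ʳ-last (as μ)) (get-∷ʳ-< (0 ∷ as μ) (n<1+n (suc n))))
             (cong₂ _+_ (get-≥ (bs μ ∷ʳ β) ≤-refl) (get-∷ʳ-< (0 ∷ 0 ∷ cs μ) (n<1+n (suc n)))) ⟩
      α + A + C            ≡⟨ +-assoc α A C ⟩
      α + (A + C)          ≡⟨ +-comm α (A + C) ⟩
      A + C + α            ≡⟨ cong₂ (λ y z → y + A + (z + C) + α)
                                     (sym (get-≥ (as μ) ≤-refl)) (sym (get-≥ (bs μ) (n≤1+n n))) ⟩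
      spineDeg μ (suc n) + α ∎
      where
      A C : ℕ
      A = get (0 ∷ as μ) (suc n)
      C = get (0 ∷ 0 ∷ cs μ) (suc n)

    spineDeg-▷-2+n : spineDeg (μ ▷ (β , γ , α)) (suc (suc n)) ≡ α + γ
    spineDeg-▷-2+n = cong₂ _+_
      (cong₂ _+_ (get-≥ (as μ ∷ʳ α) ≤-refl) (get-∷ʳ-last (0 ∷ as μ)))
      (cong₂ _+_ (get-≥ (bs μ ∷ʳ β) (n≤1+n (suc n))) (get-∷ʳ-last (0 ∷ 0 ∷ cs μ)))

    outerDeg-▷-< : ∀ {t} → t < n → outerDeg (μ ▷ (β , γ , α)) t ≡ outerDeg μ t
    outerDeg-▷-< t<n = cong₂ _+_ (get-∷ʳ-< (bs μ) t<n) (get-∷ʳ-< (cs μ) t<n)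

    outerDeg-▷-n : outerDeg (μ ▷ (β , γ , α)) n ≡ β + γ
    outerDeg-▷-n = cong₂ _+_ (get-∷ʳ-last (bs μ)) (get-∷ʳ-last (cs μ))

  -- The labeling x puts x t on P_t = {u_t , w_t} for t < n and x n on P_n = {u_n , u_{n+1}}.
  record IsCoverₘ (n : ℕ) (x : ℕ → ℕ) (μ : Mult n) : Set where
    field
      spine     : ∀ t → t < n → spineDeg μ t ≡ x t
      outer     : ∀ t → t < n → outerDeg μ t ≡ x t
      spine-n   : spineDeg μ n ≡ x n
      spine-1+n : spineDeg μ (suc n) ≡ x n

  TileFits : (ℕ → ℕ) → ℕ → Tile → Set
  TileFits x n (β , γ , α) = β + γ ≡ x n × γ + α ≡ x (suc n)

  ▷-fits : ∀ {n x} (μ : Mult n) {β γ α} →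
    IsCoverₘ (suc n) x (μ ▷ (β , γ , α)) → TileFits x n (β , γ , α)
  ▷-fits {n} μ {β} {γ} {α} cov =
    trans (sym (outerDeg-▷-n μ β γ α)) (outer n (n<1+n n)) ,
    trans (+-comm γ α) (trans (sym (spineDeg-▷-2+n μ β γ α)) spine-1+n)
    where open IsCoverₘ cov

  IsCoverₘ-▷ : ∀ {n x y} (μ : Mult n) {β γ α} →
    (∀ t → t < n → y t ≡ x t) → y n ≡ γ → TileFits x n (β , γ , α) →
    IsCoverₘ (suc n) x (μ ▷ (β , γ , α)) ⇔ IsCoverₘ n y μ
  IsCoverₘ-▷ {n} {x} {y} μ {β} {γ} {α} y≡x yn≡γ (fits-b , fits-a) = mk⇔ to from
    where
    open ≡-Reasoning

    to : IsCoverₘ (suc n) x (μ ▷ (β , γ , α)) → IsCoverₘ n y μ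
    to cov = record
      { spine     = λ t t<n → trans (sym (spineDeg-▷-< μ β γ α t<n))
                                     (trans (spine t (m<n⇒m<1+n t<n)) (sym (y≡x t t<n)))
      ; outer     = λ t t<n → trans (sym (outerDeg-▷-< μ β γ α t<n))
                                     (trans (outer t (m<n⇒m<1+n t<n)) (sym (y≡x t t<n)))
      ; spine-n   = trans (+-cancelʳ-≡ β _ _ (begin
          spineDeg μ n + β              ≡⟨ sym (spineDeg-▷-n μ β γ α) ⟩
          spineDeg (μ ▷ (β , γ , α)) n  ≡⟨ spine n (n<1+n n) ⟩
          x n                           ≡⟨ sym fits-b ⟩
          β + γ                         ≡⟨ +-comm β γ ⟩
          γ + β                         ∎)) (sym yn≡γ)
      ; spine-1+n = trans (+-cancelʳ-≡ α _ _ (begin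
          spineDeg μ (suc n) + α              ≡⟨ sym (spineDeg-▷-1+n μ β γ α) ⟩
          spineDeg (μ ▷ (β , γ , α)) (suc n)  ≡⟨ spine-n ⟩
          x (suc n)                           ≡⟨ sym fits-a ⟩
          γ + α                               ∎)) (sym yn≡γ)
      }
      where open IsCoverₘ cov

    from : IsCoverₘ n y μ → IsCoverₘ (suc n) x (μ ▷ (β , γ , α))
    from cov = record
      { spine     = spine′
      ; outer     = outer′
      ; spine-n   = trans (spineDeg-▷-1+n μ β γ α) (trans (cong (_+ α) (trans spine-1+n yn≡γ)) fits-a)
      ; spine-1+n = trans (spineDeg-▷-2+n μ β γ α) (trans (+-comm α γ) fits-a)
      }
      where
      open IsCoverₘ cov
      spine′ : ∀ t → t < suc n → spineDeg (μ ▷ (β , γ , α)) t ≡ x t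
      spine′ t t<1+n with m<1+n⇒m<n∨m≡n t<1+n
      ... | inj₁ t<n  = trans (spineDeg-▷-< μ β γ α t<n) (trans (spine t t<n) (y≡x t t<n))
      ... | inj₂ refl = trans (spineDeg-▷-n μ β γ α)
                              (trans (cong (_+ β) (trans spine-n yn≡γ)) (trans (+-comm γ β) fits-b))
      outer′ : ∀ t → t < suc n → outerDeg (μ ▷ (β , γ , α)) t ≡ x t
      outer′ t t<1+n with m<1+n⇒m<n∨m≡n t<1+n
      ... | inj₁ t<n  = trans (outerDeg-▷-< μ β γ α t<n) (trans (outer t t<n) (y≡x t t<n))
      ... | inj₂ refl = trans (outerDeg-▷-n μ β γ α) fits-b

  IsCoverₘ-zero : ∀ {y} (μ : Mult 0) → IsCoverₘ 0 y μ ⇔ μ ≡ mult (y 0 ∷ []) [] []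
  IsCoverₘ-zero {y} (mult (a₀ ∷ []) [] []) = mk⇔ to from
    where
    to : IsCoverₘ 0 y (mult (a₀ ∷ []) [] []) → mult (a₀ ∷ []) [] [] ≡ mult (y 0 ∷ []) [] []
    to cov = cong (λ e → mult (e ∷ []) [] [])
                  (trans (sym (trans (+-identityʳ _) (+-identityʳ a₀))) (IsCoverₘ.spine-n cov))
    from : mult (a₀ ∷ []) [] [] ≡ mult (y 0 ∷ []) [] [] → IsCoverₘ 0 y (mult (a₀ ∷ []) [] [])
    from refl = record
      { spine     = λ _ ()
      ; outer     = λ _ ()
      ; spine-n   = trans (+-identityʳ _) (+-identityʳ (y 0))
      ; spine-1+n = +-identityʳ (y 0)
      }

  trunc : ∀ {n} → Mult (suc n) → Mult n
  trunc (mult as bs cs) = mult (init as) (init bs) (init cs)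

  top : ∀ {n} → Mult (suc n) → Tile
  top (mult as bs cs) = last bs , last cs , last as

  trunc-▷ : ∀ {n} (μ : Mult n) t → trunc (μ ▷ t) ≡ μ
  trunc-▷ (mult as bs cs) (β , γ , α) rewrite init-∷ʳ α as | init-∷ʳ β bs | init-∷ʳ γ cs = refl

  top-▷ : ∀ {n} (μ : Mult n) t → top (μ ▷ t) ≡ t
  top-▷ (mult as bs cs) (β , γ , α) rewrite last-∷ʳ α as | last-∷ʳ β bs | last-∷ʳ γ cs = refl

  trunc-▷-top : ∀ {n} (μ : Mult (suc n)) → trunc μ ▷ top μ ≡ μ
  trunc-▷-top (mult as bs cs) rewrite init∷ʳlast as | init∷ʳlast bs | init∷ʳlast cs = refl

  top-fits : ∀ {n x} (μ : Mult (suc n)) → IsCoverₘ (suc n) x μ → TileFits x n (top μ)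
  top-fits μ cov = ▷-fits (trunc μ) (subst (IsCoverₘ _ _) (sym (trunc-▷-top μ)) cov)

  IsCoverWithTop : ∀ n → (ℕ → ℕ) → Tile → Mult (suc n) → Set
  IsCoverWithTop n x t μ = IsCoverₘ (suc n) x μ × top μ ≡ t

  module _ {n x β γ α} {L : List (Mult (suc n))} (enum : L Enumerates IsCoverWithTop n x (β , γ , α)) where

    private
      tile : Tile
      tile = β , γ , α

      trunc-section : ∀ μ → IsCoverWithTop n x tile μ → trunc μ ▷ tile ≡ μ
      trunc-section μ (_ , top≡tile) = subst (λ t → trunc μ ▷ t ≡ μ) top≡tile (trunc-▷-top μ)

    map-trunc-▷ : map (_▷ tile) (map trunc L) ≡ L
    map-trunc-▷ = map-section (_▷ tile) trunc (λ μ → trunc-▷ μ tile) enum trunc-section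

    Enumerates-trunc : ∀ {y} → (∀ t → t < n → y t ≡ x t) → y n ≡ γ → TileFits x n tile →
      map trunc L Enumerates IsCoverₘ n y
    Enumerates-trunc y≡x yn≡γ fits =
      Enumerates-⇔ (Enumerates-pullback (_▷ tile) trunc (λ μ → trunc-▷ μ tile) enum trunc-section)
        λ μ → mk⇔
        (λ (cov , _) → Equivalence.to (IsCoverₘ-▷ μ y≡x yn≡γ fits) cov)
        (λ cov → Equivalence.from (IsCoverₘ-▷ μ y≡x yn≡γ fits) cov , top-▷ μ tile)

  +≡∸⇒≡∸ : ∀ {u v X I} → u + v ≡ X ∸ I → v ≡ X ∸ (I + u)
  +≡∸⇒≡∸ {u} {v} {X} {I} eq = trans (sym (m+n∸m≡n u v)) (trans (cong (_∸ u) eq) (∸-+-assoc X I u))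

  +≡∸⇒≤ : ∀ {u v X I} → I ≤ X → u + v ≡ X ∸ I → u + I ≤ X
  +≡∸⇒≤ {u} {v} I≤X eq = m≤o∸n⇒m+n≤o u I≤X (subst (u ≤_) eq (m≤m+n u v))

  ≤⇒+≡∸ : ∀ {u X I} → u + I ≤ X → u + (X ∸ (u + I)) ≡ X ∸ I
  ≤⇒+≡∸ {u} {X} {I} u+I≤X = trans (cong (λ z → u + (X ∸ z)) (+-comm u I))
    (trans (cong (u +_) (sym (∸-+-assoc X I u))) (m+[n∸m]≡n (m+n≤o⇒m≤o∸n u u+I≤X)))

  modLab-below : ∀ {N} m I J {t} → t < N → modLab N m I J t ≡ (if t ≡ᵇ 0 then m 0 ∸ I else m t)
  modLab-below {N} m I J {t} t<N =
    cong (if t ≡ᵇ 0 then m 0 ∸ I else_) (if-false (<⇒≢ t<N ∘ ≡ᵇ⇒≡ t N))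

  modLab-top : ∀ {N} m I J → modLab (suc N) m I J (suc N) ≡ m (suc N) ∸ J
  modLab-top {N} m I J = if-true (≡⇒≡ᵇ N N refl)

module Geometry where

  open import Data.Nat using (zero; _+_; _∸_; _<_; _≡ᵇ_; ⌊_/2⌋; z≤n; s≤s)
  open import Data.Nat.Properties
    using (_≟_; ≤-refl; <⇒≤; <⇒≱; m≤n⇒m≤1+n; m≤n⇒m<n∨m≡n; m<1+n⇒m<n∨m≡n; n≤1+n; +-assoc;
           +-identityʳ; +-commutativeSemigroup; ≡ᵇ⇒≡; ≡⇒≡ᵇ)
  open import Data.Bool using (Bool; false; _∨_)
  open import Data.Bool.Properties using (∧-zeroʳ; ∨-identityʳ)
  open import Data.Fin as Fin using ()
  open import Data.Vec using ([]; _∷_; _++_; lookup; tabulate; replicate; take; drop)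
  open import Data.Vec.Properties using (lookup∘tabulate; take++drop≡id; ++-injectiveˡ; ++-injectiveʳ)
  open import Data.Sum using (inj₁; inj₂)
  open import Data.List using ([]; _∷_; foldr; upTo)
  open import Data.List.Relation.Binary.Permutation.Propositional using (_↭_; ↭-refl; ↭-sym; prep; swap)
  open import Data.List.Relation.Binary.Permutation.Propositional.Properties using (∈-resp-↭)
  open import Data.List.Relation.Unary.Any using (here; there)
  open import Data.List.Membership.Propositional.Properties using (∈-upTo⁺; ∈-upTo⁻)
  open import Relation.Nullary using (yes; no)
  open import Data.Empty using (⊥-elim)
  open import Function using (_∘_; mk⇔)
  open ≡ using (refl; cong; cong₂; sym; trans)

  open Covers
  open Enumerations

  double : ℕ → ℕ
  double zero    = zero
  double (suc j) = suc (suc (double j))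

  data Parity : ℕ → Set where
    twice   : ∀ j → Parity (double j)
    twice+1 : ∀ j → Parity (suc (double j))

  parity : ∀ t → Parity t
  parity zero          = twice zero
  parity (suc zero)    = twice+1 zero
  parity (suc (suc t)) with parity t
  ... | twice j   = twice (suc j)
  ... | twice+1 j = twice+1 (suc j)

  odd-double : ∀ j → odd (double j) ≡ false
  odd-double zero    = refl
  odd-double (suc j) rewrite odd-double j = refl

  ⌊double/2⌋ : ∀ j → ⌊ double j /2⌋ ≡ j
  ⌊double/2⌋ zero    = refl
  ⌊double/2⌋ (suc j) = cong suc (⌊double/2⌋ j)

  ⌊1+double/2⌋ : ∀ j → ⌊ suc (double j) /2⌋ ≡ j
  ⌊1+double/2⌋ zero    = refl
  ⌊1+double/2⌋ (suc j) = cong suc (⌊1+double/2⌋ j)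

  shift : Point → Point
  shift (x , y) = suc x , suc y

  spinePt outerPt : ℕ → Point
  spinePt zero          = 0 , 0
  spinePt (suc zero)    = 0 , 1
  spinePt (suc (suc t)) = shift (spinePt t)
  outerPt zero          = 1 , 0
  outerPt (suc zero)    = 0 , 2
  outerPt (suc (suc t)) = shift (outerPt t)

  spinePt-double : ∀ j → spinePt (double j) ≡ (j , j)
  spinePt-double zero    = refl
  spinePt-double (suc j) = cong shift (spinePt-double j)

  spinePt-1+double : ∀ j → spinePt (suc (double j)) ≡ (j , suc j)
  spinePt-1+double zero    = refl
  spinePt-1+double (suc j) = cong shift (spinePt-1+double j)

  outerPt-double : ∀ j → outerPt (double j) ≡ (suc j , j)
  outerPt-double zero    = refl
  outerPt-double (suc j) = cong shift (outerPt-double j)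

  outerPt-1+double : ∀ j → outerPt (suc (double j)) ≡ (j , suc (suc j))
  outerPt-1+double zero    = refl
  outerPt-1+double (suc j) = cong shift (outerPt-1+double j)

  spine==spine : ∀ s t → (spinePt s ==P spinePt t) ≡ (s ≡ᵇ t)
  spine==spine zero          zero          = refl
  spine==spine zero          (suc zero)    = refl
  spine==spine zero          (suc (suc t)) = refl
  spine==spine (suc zero)    zero          = refl
  spine==spine (suc zero)    (suc zero)    = refl
  spine==spine (suc zero)    (suc (suc t)) = refl
  spine==spine (suc (suc s)) zero          = refl
  spine==spine (suc (suc s)) (suc zero)    = refl
  spine==spine (suc (suc s)) (suc (suc t)) = spine==spine s t

  outer==outer : ∀ s t → (outerPt s ==P outerPt t) ≡ (s ≡ᵇ t)
  outer==outer zero          zero          = refl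
  outer==outer zero          (suc zero)    = refl
  outer==outer zero          (suc (suc t)) = ∧-zeroʳ _
  outer==outer (suc zero)    zero          = refl
  outer==outer (suc zero)    (suc zero)    = refl
  outer==outer (suc zero)    (suc (suc t)) = refl
  outer==outer (suc (suc s)) zero          = ∧-zeroʳ _
  outer==outer (suc (suc s)) (suc zero)    = refl
  outer==outer (suc (suc s)) (suc (suc t)) = outer==outer s t

  spine==outer : ∀ s t → (spinePt s ==P outerPt t) ≡ false
  spine==outer zero          zero          = refl
  spine==outer zero          (suc zero)    = refl
  spine==outer zero          (suc (suc t)) = refl
  spine==outer (suc zero)    zero          = refl
  spine==outer (suc zero)    (suc zero)    = refl
  spine==outer (suc zero)    (suc (suc t)) = refl
  spine==outer (suc (suc s)) zero          = ∧-zeroʳ _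
  spine==outer (suc (suc s)) (suc zero)    = refl
  spine==outer (suc (suc s)) (suc (suc t)) = spine==outer s t

  outer==spine : ∀ s t → (outerPt s ==P spinePt t) ≡ false
  outer==spine zero          zero          = refl
  outer==spine zero          (suc zero)    = refl
  outer==spine zero          (suc (suc t)) = ∧-zeroʳ _
  outer==spine (suc zero)    zero          = refl
  outer==spine (suc zero)    (suc zero)    = refl
  outer==spine (suc zero)    (suc (suc t)) = refl
  outer==spine (suc (suc s)) zero          = refl
  outer==spine (suc (suc s)) (suc zero)    = refl
  outer==spine (suc (suc s)) (suc (suc t)) = outer==spine s t

  ends-a : ∀ t → ends (a t) ≡ (spinePt t , spinePt (suc t))
  ends-a zero    = refl
  ends-a (suc t) with parity t
  ... | twice j   rewrite odd-double j | ⌊1+double/2⌋ j | spinePt-double j | spinePt-1+double j = refl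
  ... | twice+1 j rewrite odd-double (suc j) | ⌊double/2⌋ j | spinePt-double (suc j)
                        | spinePt-1+double j = refl

  ends-b : ∀ t → ends (b (suc t)) ≡ (spinePt t , outerPt t)
  ends-b t with parity t
  ... | twice j   rewrite odd-double j | ⌊1+double/2⌋ j | spinePt-double j | outerPt-double j = refl
  ... | twice+1 j rewrite odd-double (suc j) | ⌊double/2⌋ j | spinePt-1+double j | outerPt-1+double j = refl

  ends-c : ∀ t → ends (c (suc t)) ≡ (outerPt t , spinePt (suc (suc t)))
  ends-c t with parity t
  ... | twice j   rewrite odd-double j | ⌊1+double/2⌋ j | outerPt-double j | spinePt-double j = refl
  ... | twice+1 j rewrite odd-double (suc j) | ⌊double/2⌋ j | outerPt-1+double j | spinePt-1+double j = refl

  pairP-≡ : ∀ t → pairP (suc t) ≡ spinePt t ∷ outerPt t ∷ []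
  pairP-≡ t with parity t
  ... | twice j   rewrite odd-double j | ⌊1+double/2⌋ j | spinePt-double j | outerPt-double j = refl
  ... | twice+1 j rewrite odd-double (suc j) | ⌊double/2⌋ j | spinePt-1+double j | outerPt-1+double j = refl

  tileCorners : ℕ → List Point
  tileCorners t = spinePt t ∷ outerPt t ∷ spinePt (suc t) ∷ spinePt (suc (suc t)) ∷ []

  corners-↭ : ∀ t → corners (suc t) ↭ tileCorners t
  corners-↭ t with parity t
  ... | twice j   rewrite odd-double j | ⌊1+double/2⌋ j | spinePt-double j | outerPt-double j
                        | spinePt-1+double j = ↭-refl
  ... | twice+1 j rewrite odd-double (suc j) | ⌊double/2⌋ j | spinePt-1+double j | outerPt-1+double j
                        | spinePt-double j = prep _ (swap _ _ ↭-refl)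

  ∈-corners : ∀ t {v} → v ∈ tileCorners t → v ∈ corners (suc t)
  ∈-corners t = ∈-resp-↭ (↭-sym (corners-↭ t))

  spinePt-vertex : ∀ {n t} → 1 ≤ n → t ≤ suc n → IsVertex n (spinePt t)
  spinePt-vertex {t = zero}  1≤n _ = 1 , ≤-refl , 1≤n , ∈-corners 0 (here refl)
  spinePt-vertex {n} {suc t} 1≤n (s≤s t≤n) with m≤n⇒m<n∨m≡n t≤n
  ... | inj₁ t<n  = suc t , s≤s z≤n , t<n , ∈-corners t (there (there (here refl)))
  spinePt-vertex {suc n} {suc t} 1≤n (s≤s t≤n) | inj₂ refl =
    suc n , s≤s z≤n , ≤-refl , ∈-corners n (there (there (there (here refl))))

  outerPt-vertex : ∀ {n t} → t < n → IsVertex n (outerPt t)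
  outerPt-vertex {t = t} t<n = suc t , s≤s z≤n , t<n , ∈-corners t (there (here refl))

  data Vertex (n : ℕ) : Point → Set where
    spine-vertex : ∀ {t} → t ≤ suc n → Vertex n (spinePt t)
    outer-vertex : ∀ {t} → t < n → Vertex n (outerPt t)

  vertex-view : ∀ {n v} → IsVertex n v → Vertex n v
  vertex-view {n} (suc t , _ , t<n , v∈) = corner (∈-resp-↭ (corners-↭ t) v∈)
    where
    corner : ∀ {v} → v ∈ tileCorners t → Vertex n v
    corner (here refl)                         = spine-vertex (m≤n⇒m≤1+n (<⇒≤ t<n))
    corner (there (here refl))                 = outer-vertex t<n
    corner (there (there (here refl)))         = spine-vertex (m≤n⇒m≤1+n t<n)
    corner (there (there (there (here refl)))) = spine-vertex (s≤s t<n)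

  when : Bool → ℕ → ℕ
  when p w = if p then w else 0

  sumℕ-cong : ∀ k {f g : Fin k → ℕ} → (∀ e → f e ≡ g e) → sumℕ k f ≡ sumℕ k g
  sumℕ-cong zero    _   = refl
  sumℕ-cong (suc k) f≗g = cong₂ _+_ (f≗g Fin.zero) (sumℕ-cong k (f≗g ∘ Fin.suc))

  sumℕ-zero : ∀ k → sumℕ k (λ _ → 0) ≡ 0
  sumℕ-zero zero    = refl
  sumℕ-zero (suc k) = sumℕ-zero k

  sumℕ-+ : ∀ k (f g : Fin k → ℕ) → sumℕ k (λ e → f e + g e) ≡ sumℕ k f + sumℕ k g
  sumℕ-+ zero    f g = refl
  sumℕ-+ (suc k) f g = trans (cong (f Fin.zero + g Fin.zero +_) (sumℕ-+ k (f ∘ Fin.suc) (g ∘ Fin.suc)))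
                             (+-interchange (f Fin.zero) (g Fin.zero) _ _)
    where open import Algebra.Properties.CommutativeSemigroup +-commutativeSemigroup
            using () renaming (interchange to +-interchange)

  sumℕ-++ : ∀ {A : Set} {p q} (F : A → ℕ → ℕ) (xs : Vec A p) (ys : Vec A q)
            (vs : Vec ℕ p) (ws : Vec ℕ q) →
    sumℕ (p + q) (λ e → F (lookup (xs ++ ys) e) (lookup (vs ++ ws) e)) ≡
    sumℕ p (λ e → F (lookup xs e) (lookup vs e)) + sumℕ q (λ e → F (lookup ys e) (lookup ws e))
  sumℕ-++ F []       ys []       ws = refl
  sumℕ-++ F (x ∷ xs) ys (v ∷ vs) ws =
    trans (cong (F x v +_) (sumℕ-++ F xs ys vs ws)) (sym (+-assoc (F x v) _ _))

  sumℕ-tabulate : ∀ {A : Set} {k} (F : A → ℕ → ℕ) (g : Fin k → A) (vs : Vec ℕ k) →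
    sumℕ k (λ e → F (lookup (tabulate g) e) (lookup vs e)) ≡ sumℕ k (λ e → F (g e) (lookup vs e))
  sumℕ-tabulate {k = k} F g vs = sumℕ-cong k (λ e → cong (λ l → F l (lookup vs e)) (lookup∘tabulate g e))

  δ-sum : ∀ s {k} (v : Vec ℕ k) t →
    sumℕ k (λ e → when (s + toℕ e ≡ᵇ t) (lookup v e)) ≡ get (replicate s 0 ++ v) t
  δ-sum zero    []            t       = refl
  δ-sum zero    (_∷_ {k} d v) zero    = trans (cong (d +_) (sumℕ-zero k)) (+-identityʳ d)
  δ-sum zero    (d ∷ v)       (suc t) = δ-sum zero v t
  δ-sum (suc s) {k} v         zero    = sumℕ-zero k
  δ-sum (suc s) v             (suc t) = δ-sum s v t

  fromMult : ∀ {n} → Mult n → Vec ℕ (E n)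
  fromMult (mult as bs cs) = as ++ (bs ++ cs)

  edgeSum : ∀ {k} → Point → (ℕ → Lab) → Vec ℕ k → ℕ
  edgeSum {k} v l ws = sumℕ k (λ e → when (incident v (l (toℕ e))) (lookup ws e))

  edgeSum-incident : ∀ {k} v l (ws : Vec ℕ k) {P : ℕ → Bool} → (∀ e → incident v (l e) ≡ P e) →
    edgeSum v l ws ≡ sumℕ k (λ e → when (P (toℕ e)) (lookup ws e))
  edgeSum-incident {k} v l ws inc = sumℕ-cong k (λ e → cong (λ p → when p (lookup ws e)) (inc (toℕ e)))

  deg-fromMult : ∀ n v (μ : Mult n) →
    deg n (fromMult μ) v ≡ edgeSum v a (as μ) + (edgeSum v (b ∘ suc) (bs μ) + edgeSum v (c ∘ suc) (cs μ))
  deg-fromMult n v (mult as bs cs) =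
    trans (sumℕ-++ (contrib v) a-edges (b-edges ++ c-edges) as (bs ++ cs))
      (cong₂ _+_ (sumℕ-tabulate (contrib v) (a ∘ toℕ) as)
        (trans (sumℕ-++ (contrib v) b-edges c-edges bs cs)
          (cong₂ _+_ (sumℕ-tabulate (contrib v) (b ∘ suc ∘ toℕ) bs)
                     (sumℕ-tabulate (contrib v) (c ∘ suc ∘ toℕ) cs))))
    where
    contrib : Point → Lab → ℕ → ℕ
    contrib v l = when (incident v l)
    a-edges : Vec Lab (suc n)
    a-edges = tabulate (a ∘ toℕ)
    b-edges c-edges : Vec Lab n
    b-edges = tabulate (b ∘ suc ∘ toℕ)
    c-edges = tabulate (c ∘ suc ∘ toℕ)

  incident-spine-a : ∀ t e → incident (spinePt t) (a e) ≡ (e ≡ᵇ t) ∨ (suc e ≡ᵇ t)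
  incident-spine-a t e rewrite ends-a e | spine==spine e t | spine==spine (suc e) t = refl

  incident-spine-b : ∀ t e → incident (spinePt t) (b (suc e)) ≡ (e ≡ᵇ t)
  incident-spine-b t e rewrite ends-b e | spine==spine e t | outer==spine e t = ∨-identityʳ _

  incident-spine-c : ∀ t e → incident (spinePt t) (c (suc e)) ≡ (suc (suc e) ≡ᵇ t)
  incident-spine-c t e rewrite ends-c e | outer==spine e t | spine==spine (suc (suc e)) t = refl

  incident-outer-a : ∀ t e → incident (outerPt t) (a e) ≡ false
  incident-outer-a t e rewrite ends-a e | spine==outer e t | spine==outer (suc e) t = refl

  incident-outer-b : ∀ t e → incident (outerPt t) (b (suc e)) ≡ (e ≡ᵇ t)
  incident-outer-b t e rewrite ends-b e | spine==outer e t | outer==outer e t = refl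

  incident-outer-c : ∀ t e → incident (outerPt t) (c (suc e)) ≡ (e ≡ᵇ t)
  incident-outer-c t e rewrite ends-c e | outer==outer e t | spine==outer (suc (suc e)) t = ∨-identityʳ _

  when-∨-suc : ∀ e t w → when ((e ≡ᵇ t) ∨ (suc e ≡ᵇ t)) w ≡ when (e ≡ᵇ t) w + when (suc e ≡ᵇ t) w
  when-∨-suc zero    zero    w = sym (+-identityʳ w)
  when-∨-suc zero    (suc t) w = refl
  when-∨-suc (suc e) zero    w = refl
  when-∨-suc (suc e) (suc t) w = when-∨-suc e t w

  deg-spinePt : ∀ n t (μ : Mult n) → deg n (fromMult μ) (spinePt t) ≡ spineDeg μ t
  deg-spinePt n t μ = trans (deg-fromMult n (spinePt t) μ) (cong₂ _+_ a-part (cong₂ _+_ b-part c-part))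
    where
    ws : Vec ℕ (suc n)
    ws = as μ
    a-part : edgeSum (spinePt t) a ws ≡ get ws t + get (0 ∷ ws) t
    a-part = trans (edgeSum-incident (spinePt t) a ws (incident-spine-a t))
      (trans (sumℕ-cong (suc n) (λ e → when-∨-suc (toℕ e) t (lookup ws e)))
        (trans (sumℕ-+ (suc n) (λ e → when (toℕ e ≡ᵇ t) (lookup ws e))
                               (λ e → when (suc (toℕ e) ≡ᵇ t) (lookup ws e)))
               (cong₂ _+_ (δ-sum 0 ws t) (δ-sum 1 ws t))))
    b-part : edgeSum (spinePt t) (b ∘ suc) (bs μ) ≡ get (bs μ) t
    b-part = trans (edgeSum-incident (spinePt t) (b ∘ suc) (bs μ) (incident-spine-b t)) (δ-sum 0 (bs μ) t)
    c-part : edgeSum (spinePt t) (c ∘ suc) (cs μ) ≡ get (0 ∷ 0 ∷ cs μ) t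
    c-part = trans (edgeSum-incident (spinePt t) (c ∘ suc) (cs μ) (incident-spine-c t)) (δ-sum 2 (cs μ) t)

  deg-outerPt : ∀ n t (μ : Mult n) → deg n (fromMult μ) (outerPt t) ≡ outerDeg μ t
  deg-outerPt n t μ = trans (deg-fromMult n (outerPt t) μ) (cong₂ _+_ a-part (cong₂ _+_ b-part c-part))
    where
    a-part : edgeSum (outerPt t) a (as μ) ≡ 0
    a-part = trans (edgeSum-incident (outerPt t) a (as μ) (incident-outer-a t)) (sumℕ-zero (suc n))
    b-part : edgeSum (outerPt t) (b ∘ suc) (bs μ) ≡ get (bs μ) t
    b-part = trans (edgeSum-incident (outerPt t) (b ∘ suc) (bs μ) (incident-outer-b t)) (δ-sum 0 (bs μ) t)
    c-part : edgeSum (outerPt t) (c ∘ suc) (cs μ) ≡ get (cs μ) t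
    c-part = trans (edgeSum-incident (outerPt t) (c ∘ suc) (cs μ) (incident-outer-c t)) (δ-sum 0 (cs μ) t)

  memP-spine : ∀ s k → memP (spinePt s) (pairP (suc k)) ≡ (s ≡ᵇ k)
  memP-spine s k rewrite pairP-≡ k | spine==spine s k | spine==outer s k = ∨-identityʳ _

  memP-outer : ∀ s k → memP (outerPt s) (pairP (suc k)) ≡ (s ≡ᵇ k)
  memP-outer s k rewrite pairP-≡ k | outer==spine s k | outer==outer s k = ∨-identityʳ _

  module _ (x : ℕ → ℕ) {v : Point} {s : ℕ} (memP-v : ∀ k → memP v (pairP (suc k)) ≡ (s ≡ᵇ k)) where

    private
      labelStep : ℕ → ℕ → ℕ
      labelStep k r = if memP v (pairP k) then x (k ∸ 1) else r

    foldr-label-∈ : ∀ {ks} d → s ∈ ks → foldr labelStep d (map suc ks) ≡ x s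
    foldr-label-∈ {k ∷ ks} d s∈ rewrite memP-v k with s ≟ k | s∈
    ... | yes refl | _          = if-true (≡⇒≡ᵇ s s refl)
    ... | no  s≢k  | here s≡k   = ⊥-elim (s≢k s≡k)
    ... | no  s≢k  | there s∈ks = trans (if-false (s≢k ∘ ≡ᵇ⇒≡ s k)) (foldr-label-∈ d s∈ks)

    foldr-label-∉ : ∀ ks d → ¬ s ∈ ks → foldr labelStep d (map suc ks) ≡ d
    foldr-label-∉ []       d _  = refl
    foldr-label-∉ (k ∷ ks) d s∉ rewrite memP-v k with s ≟ k
    ... | yes refl = ⊥-elim (s∉ (here refl))
    ... | no  s≢k  = trans (if-false (s≢k ∘ ≡ᵇ⇒≡ s k)) (foldr-label-∉ ks d (s∉ ∘ there))

  label-spine-< : ∀ n x {s} → s < n → label n x (spinePt s) ≡ x s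
  label-spine-< n x {s} s<n = foldr-label-∈ x (memP-spine s) (x n) (∈-upTo⁺ s<n)

  label-spine-≥ : ∀ n x {s} → n ≤ s → label n x (spinePt s) ≡ x n
  label-spine-≥ n x {s} n≤s =
    foldr-label-∉ x (memP-spine s) (upTo n) (x n) (λ s∈ → <⇒≱ (∈-upTo⁻ s∈) n≤s)

  label-outer : ∀ n x {s} → s < n → label n x (outerPt s) ≡ x s
  label-outer n x {s} s<n = foldr-label-∈ x (memP-outer s) (x n) (∈-upTo⁺ s<n)

  -- For n = 0 the graph of Defs has no vertex at all (IsVertex asks for a tile), while IsCoverₘ 0 fixes a₀.
  IsCover⇔IsCoverₘ : ∀ n x (μ : Mult n) → 1 ≤ n → IsCover n (label n x) (fromMult μ) ⇔ IsCoverₘ n x μ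
  IsCover⇔IsCoverₘ n x μ 1≤n = mk⇔ to from
    where
    to : IsCover n (label n x) (fromMult μ) → IsCoverₘ n x μ
    to cov = record
      { spine     = λ t t<n → at-spine (spinePt-vertex 1≤n (m≤n⇒m≤1+n (<⇒≤ t<n))) (label-spine-< n x t<n)
      ; outer     = λ t t<n → trans (sym (deg-outerPt n t μ))
                                     (trans (cov _ (outerPt-vertex t<n)) (label-outer n x t<n))
      ; spine-n   = at-spine (spinePt-vertex 1≤n (n≤1+n n)) (label-spine-≥ n x ≤-refl)
      ; spine-1+n = at-spine (spinePt-vertex 1≤n ≤-refl) (label-spine-≥ n x (n≤1+n n))
      }
      where
      at-spine : ∀ {t y} → IsVertex n (spinePt t) → label n x (spinePt t) ≡ y → spineDeg μ t ≡ y
      at-spine {t} isV eq = trans (sym (deg-spinePt n t μ)) (trans (cov _ isV) eq)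

    from : IsCoverₘ n x μ → IsCover n (label n x) (fromMult μ)
    from cov v isV = at (vertex-view isV)
      where
      open IsCoverₘ cov
      at : ∀ {v} → Vertex n v → deg n (fromMult μ) v ≡ label n x v
      at (outer-vertex {t} t<n) = trans (deg-outerPt n t μ) (trans (outer t t<n) (sym (label-outer n x t<n)))
      at (spine-vertex {t} t≤1+n) with m≤n⇒m<n∨m≡n t≤1+n
      ... | inj₂ refl = trans (deg-spinePt n (suc n) μ) (trans spine-1+n (sym (label-spine-≥ n x (n≤1+n n))))
      ... | inj₁ t<1+n with m<1+n⇒m<n∨m≡n t<1+n
      ...   | inj₁ t<n  = trans (deg-spinePt n t μ) (trans (spine t t<n) (sym (label-spine-< n x t<n)))
      ...   | inj₂ refl = trans (deg-spinePt n n μ) (trans spine-n (sym (label-spine-≥ n x ≤-refl)))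

  toMult : ∀ {n} → Vec ℕ (E n) → Mult n
  toMult {n} ω = mult (take (suc n) ω) (take n (drop (suc n) ω)) (drop n (drop (suc n) ω))

  fromMult-toMult : ∀ {n} (ω : Vec ℕ (E n)) → fromMult {n} (toMult ω) ≡ ω
  fromMult-toMult {n} ω =
    trans (cong (take (suc n) ω ++_) (take++drop≡id n (drop (suc n) ω))) (take++drop≡id (suc n) ω)

  fromMult-injective : ∀ {n} {μ ν : Mult n} → fromMult {n} μ ≡ fromMult ν → μ ≡ ν
  fromMult-injective {μ = mult as bs cs} {mult as′ bs′ cs′} eq
    with refl ← ++-injectiveˡ as as′ eq
    with refl ← ++-injectiveˡ bs bs′ (++-injectiveʳ as as eq)
    with refl ← ++-injectiveʳ bs bs (++-injectiveʳ as as eq) = refl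

  toMult-fromMult : ∀ {n} (μ : Mult n) → toMult (fromMult μ) ≡ μ
  toMult-fromMult {n} μ = fromMult-injective (fromMult-toMult {n} (fromMult μ))

  Enumerates-toMult : ∀ {n x} {L : List (Vec ℕ (E n))} → 1 ≤ n → L Enumerates IsCover n (label n x) →
    map (toMult {n}) L Enumerates IsCoverₘ n x
  Enumerates-toMult {n} {x} 1≤n enum =
    Enumerates-⇔ (Enumerates-pullback fromMult (toMult {n}) toMult-fromMult enum (λ ω _ → fromMult-toMult ω))
                 (λ μ → IsCover⇔IsCoverₘ n x μ 1≤n)

module Counting {ℓ₁ ℓ₂} (R : CommutativeRing ℓ₁ ℓ₂) where

  open import Data.Nat as ℕ using (zero; _∸_; _<_; _≡ᵇ_; _≤ᵇ_; z≤n; s≤s)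
  import Data.Nat.Properties as ℕₚ
  open import Data.Fin as Fin using ()
  open import Data.Fin.Properties using (toℕ<n)
  open import Data.Vec using ([]; _∷_; _∷ʳ_; _++_; lookup; tabulate)
  open import Data.Product using (_×_; proj₁; proj₂)
  open import Data.List using ([]; _∷_; filter)
  open import Data.List.Properties using (filter-accept; filter-reject; map-∘)
  open import Data.List.Relation.Unary.All using (All; []; _∷_)
  import Data.List.Relation.Unary.All as All
  open import Relation.Nullary using (yes; no)
  open import Relation.Nullary.Decidable using (_×-dec_)
  open import Function using (_∘_; mk⇔; Equivalence)
  open CommutativeRing R
  open RingDefs R
  open import Relation.Binary.Reasoning.Setoid setoid
  open import Algebra.Properties.CommutativeSemigroup *-commutativeSemigroup using (interchange; x∙yz≈y∙xz)
  open import Algebra.Properties.CommutativeSemigroup +-commutativeSemigroup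
    using () renaming (interchange to +-interchange)
  open Covers using (Mult; mult; _▷_; Tile)
  open Geometry using (fromMult; toMult; fromMult-toMult)

  pow-cong : ∀ {s t} p → s ≈ t → pow s p ≈ pow t p
  pow-cong zero    _   = refl
  pow-cong (suc p) s≈t = *-cong s≈t (pow-cong p s≈t)

  pow-+ : ∀ t p q → pow t (p ℕ.+ q) ≈ pow t p * pow t q
  pow-+ t zero    q = sym (*-identityˡ _)
  pow-+ t (suc p) q = trans (*-congˡ (pow-+ t p q)) (sym (*-assoc t (pow t p) (pow t q)))

  pow-* : ∀ s t p → pow (s * t) p ≈ pow s p * pow t p
  pow-* s t zero    = sym (*-identityˡ 1#)
  pow-* s t (suc p) = trans (*-congˡ (pow-* s t p)) (interchange s t (pow s p) (pow t p))

  pow-1# : ∀ p → pow 1# p ≈ 1#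
  pow-1# zero    = refl
  pow-1# (suc p) = trans (*-identityˡ _) (pow-1# p)

  pow-cancel : ∀ {u u⁻¹} → u * u⁻¹ ≈ 1# → ∀ q p v →
    pow u (q ℕ.+ p) * pow (u⁻¹ * v) p ≈ pow u q * pow v p
  pow-cancel {u} {u⁻¹} u*u⁻¹≈1 q p v = begin
    pow u (q ℕ.+ p) * pow (u⁻¹ * v) p            ≈⟨ *-cong (pow-+ u q p) (pow-* u⁻¹ v p) ⟩
    (pow u q * pow u p) * (pow u⁻¹ p * pow v p)  ≈⟨ *-assoc _ _ _ ⟩
    pow u q * (pow u p * (pow u⁻¹ p * pow v p))  ≈⟨ *-congˡ (sym (*-assoc _ _ _)) ⟩
    pow u q * ((pow u p * pow u⁻¹ p) * pow v p)  ≈⟨ *-congˡ (*-congʳ (sym (pow-* u u⁻¹ p))) ⟩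
    pow u q * (pow (u * u⁻¹) p * pow v p)        ≈⟨ *-congˡ (*-congʳ (trans (pow-cong p u*u⁻¹≈1)
                                                                               (pow-1# p))) ⟩
    pow u q * (1# * pow v p)                     ≈⟨ *-congˡ (*-identityˡ _) ⟩
    pow u q * pow v p                            ∎

  sumR-cong : ∀ N {f g : Fin N → Carrier} → (∀ r → f r ≈ g r) → sumR N f ≈ sumR N g
  sumR-cong zero    _   = refl
  sumR-cong (suc N) f≈g = +-cong (f≈g Fin.zero) (sumR-cong N (f≈g ∘ Fin.suc))

  sumR-zero : ∀ N {f : Fin N → Carrier} → (∀ r → f r ≈ 0#) → sumR N f ≈ 0#
  sumR-zero zero    _   = refl
  sumR-zero (suc N) f≈0 = trans (+-cong (f≈0 Fin.zero) (sumR-zero N (f≈0 ∘ Fin.suc))) (+-identityˡ 0#)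

  sumR-+ : ∀ N (f g : Fin N → Carrier) → sumR N (λ r → f r + g r) ≈ sumR N f + sumR N g
  sumR-+ zero    f g = sym (+-identityˡ 0#)
  sumR-+ (suc N) f g = trans (+-congˡ (sumR-+ N (f ∘ Fin.suc) (g ∘ Fin.suc))) (+-interchange _ _ _ _)

  sumR-single : ∀ N (f : ℕ → Carrier) {t} → t < N → (∀ ρ → ρ ≢ t → f ρ ≈ 0#) →
    sumR N (λ r → f (toℕ r)) ≈ f t
  sumR-single (suc N) f {zero}  _         f≈0 =
    trans (+-congˡ (sumR-zero N (λ r → f≈0 (suc (toℕ r)) (λ ())))) (+-identityʳ (f 0))
  sumR-single (suc N) f {suc t} (s≤s t<N) f≈0 =
    trans (+-cong (f≈0 0 (λ ()))
                  (sumR-single N (f ∘ suc) t<N (λ ρ ρ≢t → f≈0 (suc ρ) (ρ≢t ∘ ℕₚ.suc-injective))))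
          (+-identityˡ (f (suc t)))

  sumR-diagonal : ∀ N (F : ℕ → Carrier) t σ → (∀ ρ → N ≤ ρ → F ρ ≈ 0#) →
    sumR N (λ r → F (toℕ r) * (if toℕ r ≡ᵇ σ then pow t (toℕ r) else 0#)) ≈ F σ * pow t σ
  sumR-diagonal N F t σ F≈0 with σ ℕ.<? N
  ... | yes σ<N = trans (sumR-single N _ σ<N off-σ) (*-congˡ (reflexive (if-true (ℕₚ.≡⇒≡ᵇ σ σ ≡.refl))))
    where
    off-σ : ∀ ρ → ρ ≢ σ → F ρ * (if ρ ≡ᵇ σ then pow t ρ else 0#) ≈ 0#
    off-σ ρ ρ≢σ = trans (*-congˡ (reflexive (if-false (ρ≢σ ∘ ℕₚ.≡ᵇ⇒≡ ρ σ)))) (zeroʳ (F ρ))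
  ... | no  σ≮N = trans (sumR-zero N off-range) (sym (trans (*-congʳ (F≈0 σ (ℕₚ.≮⇒≥ σ≮N))) (zeroˡ _)))
    where
    off-range : ∀ r → F (toℕ r) * (if toℕ r ≡ᵇ σ then pow t (toℕ r) else 0#) ≈ 0#
    off-range r = trans (*-congˡ (reflexive (if-false r≢σ))) (zeroʳ _)
      where
      r≢σ : ¬ T (toℕ r ≡ᵇ σ)
      r≢σ eq = σ≮N (≡.subst (ℕ._< N) (ℕₚ.≡ᵇ⇒≡ _ _ eq) (toℕ<n r))

  sumList-cong : ∀ {V : Set} {f g : V → Carrier} (L : List V) → (∀ v → f v ≈ g v) →
    sumList (map f L) ≈ sumList (map g L)
  sumList-cong []      _   = refl
  sumList-cong (v ∷ L) f≈g = +-cong (f≈g v) (sumList-cong L f≈g)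

  sumList-*ʳ : ∀ {V : Set} (f : V → Carrier) x (L : List V) →
    sumList (map (λ v → f v * x) L) ≈ sumList (map f L) * x
  sumList-*ʳ f x []      = sym (zeroˡ x)
  sumList-*ʳ f x (v ∷ L) = trans (+-congˡ (sumList-*ʳ f x L)) (sym (distribʳ x (f v) _))

  sumList-fibres : ∀ {V : Set} (f : V → Carrier) (key : V → ℕ) M (L : List V) → All (λ v → key v ≤ M) L →
    sumList (map f L) ≈ sumR (suc M) (λ q → sumList (map f (filter (λ v → toℕ q ℕ.≟ key v) L)))
  sumList-fibres f key M []      []               = sym (sumR-zero (suc M) (λ _ → refl))
  sumList-fibres f key M (v ∷ L) (key≤M ∷ bounds) = begin
    f v + sumList (map f L)
      ≈⟨ +-cong (sym δ-total) (sumList-fibres f key M L bounds) ⟩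
    sumR (suc M) (λ q → δ (toℕ q)) + sumR (suc M) (λ q → fibre q L)
      ≈⟨ sym (sumR-+ (suc M) (δ ∘ toℕ) (λ q → fibre q L)) ⟩
    sumR (suc M) (λ q → δ (toℕ q) + fibre q L)
      ≈⟨ sumR-cong (suc M) add-to-fibre ⟩
    sumR (suc M) (λ q → fibre q (v ∷ L)) ∎
    where
    δ : ℕ → Carrier
    δ ρ = if ρ ≡ᵇ key v then f v else 0#
    δ-total : sumR (suc M) (λ q → δ (toℕ q)) ≈ f v
    δ-total = trans (sumR-single (suc M) δ (s≤s key≤M) δ-off) (reflexive (if-true (ℕₚ.≡⇒≡ᵇ (key v) (key v) ≡.refl)))
      where
      δ-off : ∀ ρ → ρ ≢ key v → δ ρ ≈ 0#
      δ-off ρ ρ≢key = reflexive (if-false (ρ≢key ∘ ℕₚ.≡ᵇ⇒≡ ρ (key v)))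
    fibre : Fin (suc M) → List _ → Carrier
    fibre q K = sumList (map f (filter (λ w → toℕ q ℕ.≟ key w) K))
    add-to-fibre : ∀ q → δ (toℕ q) + fibre q L ≈ fibre q (v ∷ L)
    add-to-fibre q with toℕ q ℕ.≟ key v
    ... | yes q≡key rewrite filter-accept (λ w → toℕ q ℕ.≟ key w) {xs = L} q≡key =
      +-congʳ (reflexive (if-true (ℕₚ.≡⇒≡ᵇ _ _ q≡key)))
    ... | no  q≢key rewrite filter-reject (λ w → toℕ q ℕ.≟ key w) {xs = L} q≢key =
      trans (+-congʳ (reflexive (if-false (q≢key ∘ ℕₚ.≡ᵇ⇒≡ _ _)))) (+-identityˡ _)

  monomial : ∀ {k} → (ℕ → Carrier) → Vec ℕ k → Carrier
  monomial w []      = 1#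
  monomial w (e ∷ v) = pow (w 0) e * monomial (w ∘ suc) v

  monomial-∷ʳ : ∀ {k} w (v : Vec ℕ k) e → monomial w (v ∷ʳ e) ≈ monomial w v * pow (w k) e
  monomial-∷ʳ w []      e = trans (*-identityʳ _) (sym (*-identityˡ _))
  monomial-∷ʳ w (d ∷ v) e = trans (*-congˡ (monomial-∷ʳ (w ∘ suc) v e)) (sym (*-assoc _ _ _))

  prodR-++ : ∀ {S : Set} {p q} (F : S → ℕ → Carrier) (xs : Vec S p) (ys : Vec S q)
             (vs : Vec ℕ p) (ws : Vec ℕ q) →
    prodR (p ℕ.+ q) (λ e → F (lookup (xs ++ ys) e) (lookup (vs ++ ws) e)) ≈
    prodR p (λ e → F (lookup xs e) (lookup vs e)) * prodR q (λ e → F (lookup ys e) (lookup ws e))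
  prodR-++ F []       ys []       ws = sym (*-identityˡ _)
  prodR-++ F (x ∷ xs) ys (v ∷ vs) ws = trans (*-congˡ (prodR-++ F xs ys vs ws)) (sym (*-assoc _ _ _))

  module Weights (A B C : ℕ → Carrier) where

    wtₘ : ∀ {n} → Mult n → Carrier
    wtₘ (mult as bs cs) = monomial A as * (monomial (B ∘ suc) bs * monomial (C ∘ suc) cs)

    wtₘ-edge : ∀ e → wtₘ (mult (e ∷ []) [] []) ≈ pow (A 0) e
    wtₘ-edge e = trans (*-congˡ (*-identityʳ 1#)) (trans (*-identityʳ _) (*-identityʳ _))

    prodR-tabulate : ∀ {k} (g : ℕ → Lab) (v : Vec ℕ k) →
      prodR k (λ e → pow (weight A B C (lookup (tabulate (g ∘ toℕ)) e)) (lookup v e)) ≈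
      monomial (weight A B C ∘ g) v
    prodR-tabulate g []      = refl
    prodR-tabulate g (e ∷ v) = *-congˡ (prodR-tabulate (g ∘ suc) v)

    wt-fromMult : ∀ {n} (μ : Mult n) → wt n A B C (fromMult μ) ≈ wtₘ μ
    wt-fromMult {n} (mult as bs cs) =
      trans (prodR-++ F a-edges (b-edges ++ c-edges) as (bs ++ cs))
        (*-cong (prodR-tabulate a as)
          (trans (prodR-++ F b-edges c-edges bs cs)
                 (*-cong (prodR-tabulate (b ∘ suc) bs) (prodR-tabulate (c ∘ suc) cs))))
      where
      F : Lab → ℕ → Carrier
      F l e = pow (weight A B C l) e
      a-edges : Vec Lab (suc n)
      a-edges = tabulate (a ∘ toℕ)
      b-edges c-edges : Vec Lab n
      b-edges = tabulate (b ∘ suc ∘ toℕ)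
      c-edges = tabulate (c ∘ suc ∘ toℕ)

    sumList-toMult : ∀ {n} (L : List (Vec ℕ (E n))) →
      sumList (map (wt n A B C) L) ≈ sumList (map wtₘ (map (toMult {n}) L))
    sumList-toMult {n} L = trans (sumList-cong L wt≈wtₘ) (reflexive (≡.cong sumList (map-∘ L)))
      where
      wt≈wtₘ : ∀ ω → wt n A B C ω ≈ wtₘ (toMult {n} ω)
      wt≈wtₘ ω = trans (reflexive (≡.cong (wt n A B C) (≡.sym (fromMult-toMult {n} ω))))
                       (wt-fromMult (toMult {n} ω))

    tileWt : ℕ → Tile → Carrier
    tileWt n (β , γ , α) = pow (B (suc n)) β * pow (C (suc n)) γ * pow (A (suc n)) α

    wtₘ-▷ : ∀ {n} (μ : Mult n) t → wtₘ (μ ▷ t) ≈ wtₘ μ * tileWt n t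
    wtₘ-▷ {n} (mult as bs cs) (β , γ , α) = begin
      wtₘ (mult as bs cs ▷ (β , γ , α))
        ≈⟨ *-cong (monomial-∷ʳ A as α)
                  (*-cong (monomial-∷ʳ (B ∘ suc) bs β) (monomial-∷ʳ (C ∘ suc) cs γ)) ⟩
      (mA * Aα) * ((mB * Bβ) * (mC * Cγ))  ≈⟨ *-congˡ (interchange mB Bβ mC Cγ) ⟩
      (mA * Aα) * ((mB * mC) * (Bβ * Cγ))  ≈⟨ interchange mA Aα (mB * mC) (Bβ * Cγ) ⟩
      (mA * (mB * mC)) * (Aα * (Bβ * Cγ))  ≈⟨ *-congˡ (*-comm Aα (Bβ * Cγ)) ⟩
      (mA * (mB * mC)) * (Bβ * Cγ * Aα)    ∎
      where
      mA mB mC Aα Bβ Cγ : Carrier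
      mA = monomial A as
      mB = monomial (B ∘ suc) bs
      mC = monomial (C ∘ suc) cs
      Aα = pow (A (suc n)) α
      Bβ = pow (B (suc n)) β
      Cγ = pow (C (suc n)) γ

  module StepMatrix {M₀ M₁ : ℕ} {wb wb⁻¹ wc wa : Carrier} (wb*wb⁻¹≈1 : wb * wb⁻¹ ≈ 1#)
                    (q : Fin (suc M₀)) (j : Fin (suc M₁)) where

    private
      p : ℕ
      p = M₀ ∸ toℕ q
      q≤M₀ : toℕ q ≤ M₀
      q≤M₀ = ℕₚ.≤-pred (toℕ<n q)
      WTU : Mat (suc M₀) (suc M₁)
      WTU = (W M₀ wb ⊗ Tm M₀ M₁ (wb⁻¹ * wc)) ⊗ U M₁ wa

      Wq : ℕ → Carrier
      Wq σ = if toℕ q ℕ.+ σ ≡ᵇ M₀ then pow wb M₀ else 0#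

      Uj : ℕ → Carrier
      Uj σ = if σ ℕ.+ toℕ j ≤ᵇ M₁ then pow wa (M₁ ∸ (σ ℕ.+ toℕ j)) else 0#

      Wq-off : ∀ σ → σ ≢ p → Wq σ ≈ 0#
      Wq-off σ σ≢p = reflexive (if-false (λ eq → σ≢p (≡.trans (≡.sym (ℕₚ.m+n∸m≡n (toℕ q) σ))
                                                             (≡.cong (_∸ toℕ q) (ℕₚ.≡ᵇ⇒≡ _ _ eq)))))

      WT-entry : ∀ s → (W M₀ wb ⊗ Tm M₀ M₁ (wb⁻¹ * wc)) q s ≈ Wq (toℕ s) * pow (wb⁻¹ * wc) (toℕ s)
      WT-entry s = sumR-diagonal (suc M₀) Wq (wb⁻¹ * wc) (toℕ s) λ ρ M₀<ρ →
        Wq-off ρ (λ ρ≡p → ℕₚ.<⇒≱ M₀<ρ (≡.subst (_≤ M₀) (≡.sym ρ≡p) (ℕₚ.m∸n≤m M₀ (toℕ q))))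

      term : ℕ → Carrier
      term σ = Wq σ * pow (wb⁻¹ * wc) σ * Uj σ

      entry-as-sum : WTU q j ≈ sumR (suc M₁) (term ∘ toℕ)
      entry-as-sum = sumR-cong (suc M₁) (λ s → *-congʳ {Uj (toℕ s)} (WT-entry s))

      term-off : ∀ σ → σ ≢ p → term σ ≈ 0#
      term-off σ σ≢p = trans (*-congʳ (trans (*-congʳ (Wq-off σ σ≢p)) (zeroˡ _))) (zeroˡ _)

    entry-fits : p ℕ.+ toℕ j ≤ M₁ → WTU q j ≈ pow wb (toℕ q) * pow wc p * pow wa (M₁ ∸ (p ℕ.+ toℕ j))
    entry-fits fits = begin
      WTU q j                                  ≈⟨ entry-as-sum ⟩
      sumR (suc M₁) (term ∘ toℕ)
        ≈⟨ sumR-single (suc M₁) term (s≤s (ℕₚ.m+n≤o⇒m≤o p fits)) term-off ⟩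
      Wq p * pow (wb⁻¹ * wc) p * Uj p
        ≈⟨ *-cong (*-congʳ (reflexive (if-true (ℕₚ.≡⇒≡ᵇ _ _ (ℕₚ.m+[n∸m]≡n q≤M₀)))))
                  (reflexive (if-true (ℕₚ.≤⇒≤ᵇ fits))) ⟩
      pow wb M₀ * pow (wb⁻¹ * wc) p * pow wa (M₁ ∸ (p ℕ.+ toℕ j))
        ≈⟨ *-congʳ (trans (*-congʳ (reflexive (≡.cong (pow wb) (≡.sym (ℕₚ.m+[n∸m]≡n q≤M₀)))))
                          (pow-cancel wb*wb⁻¹≈1 (toℕ q) p wc)) ⟩
      pow wb (toℕ q) * pow wc p * pow wa (M₁ ∸ (p ℕ.+ toℕ j)) ∎

    entry-¬fits : ¬ (p ℕ.+ toℕ j ≤ M₁) → WTU q j ≈ 0#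
    entry-¬fits ¬fits = trans entry-as-sum (sumR-zero (suc M₁) (term-zero ∘ toℕ))
      where
      term-zero : ∀ σ → term σ ≈ 0#
      term-zero σ with σ ℕ.≟ p
      ... | no  σ≢p    = term-off σ σ≢p
      ... | yes ≡.refl = trans (*-congˡ (reflexive (if-false (¬fits ∘ ℕₚ.≤ᵇ⇒≤ _ _)))) (zeroʳ _)

  module BaseMatrix {M₀ M₁ : ℕ} {wb wt wa : Carrier} (i : Fin (suc M₀)) (j s : Fin (suc M₁)) where

    private
      I S J : ℕ
      I = toℕ i
      S = toℕ s
      J = toℕ j
      UTU-term : Carrier
      UTU-term = (U M₀ wb ⊗ Tm M₀ M₁ wt) i s * U M₁ wa s j

      Ui : ℕ → Carrier
      Ui σ = if I ℕ.+ σ ≤ᵇ M₀ then pow wb (M₀ ∸ (I ℕ.+ σ)) else 0#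

      UT-entry : (U M₀ wb ⊗ Tm M₀ M₁ wt) i s ≈ Ui S * pow wt S
      UT-entry = sumR-diagonal (suc M₀) Ui wt S λ ρ M₀<ρ →
        reflexive (if-false (λ T → ℕₚ.<⇒≱ M₀<ρ (ℕₚ.≤-trans (ℕₚ.m≤n+m ρ I) (ℕₚ.≤ᵇ⇒≤ _ _ T))))

    term-fits : I ℕ.+ S ≤ M₀ → S ℕ.+ J ≤ M₁ →
      UTU-term ≈ pow wb (M₀ ∸ (I ℕ.+ S)) * pow wt S * pow wa (M₁ ∸ (S ℕ.+ J))
    term-fits I+S≤M₀ S+J≤M₁ =
      *-cong (trans UT-entry (*-congʳ (reflexive (if-true (ℕₚ.≤⇒≤ᵇ I+S≤M₀))))) (reflexive (if-true (ℕₚ.≤⇒≤ᵇ S+J≤M₁)))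

    term-¬fits : ¬ (I ℕ.+ S ≤ M₀ × S ℕ.+ J ≤ M₁) → UTU-term ≈ 0#
    term-¬fits ¬fits with I ℕ.+ S ℕ.≤? M₀
    ... | no  I+S≰M₀ = trans (*-congʳ (trans UT-entry (trans (*-congʳ Ui≈0) (zeroˡ _)))) (zeroˡ _)
      where
      Ui≈0 : Ui S ≈ 0#
      Ui≈0 = reflexive (if-false (I+S≰M₀ ∘ ℕₚ.≤ᵇ⇒≤ _ _))
    ... | yes I+S≤M₀ = trans (*-congˡ Uj≈0) (zeroʳ _)
      where
      Uj≈0 : U M₁ wa s j ≈ 0#
      Uj≈0 = reflexive (if-false (λ T → ¬fits (I+S≤M₀ , ℕₚ.≤ᵇ⇒≤ _ _ T)))

  module Core (m : ℕ → ℕ) (A B C Binv : ℕ → Carrier) where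

    open Weights A B C
    open Covers
    open Enumerations

    Xₘ : ∀ n → Mat (suc (m 0)) (suc (m n))
    Xₘ = X m A B C Binv

    stepMatrix : ∀ n → Mat (suc (m n)) (suc (m (suc n)))
    stepMatrix n =
      (W (m n) (B (suc n)) ⊗ Tm (m n) (m (suc n)) (Binv (suc n) * C (suc n))) ⊗ U (m (suc n)) (A (suc n))

    CountsCovers : ℕ → Set _
    CountsCovers n = (i : Fin (suc (m 0))) (j : Fin (suc (m n))) {L : List (Mult n)} →
      L Enumerates IsCoverₘ n (modLab n m (toℕ i) (toℕ j)) → sumList (map wtₘ L) ≈ Xₘ n i j

    fibre-sum : ∀ {n x β γ α} {L : List (Mult (suc n))} → L Enumerates IsCoverWithTop n x (β , γ , α) →
      sumList (map wtₘ L) ≈ sumList (map wtₘ (map trunc L)) * tileWt n (β , γ , α)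
    fibre-sum {n} {x} {β} {γ} {α} {L} enum = begin
      sumList (map wtₘ L)                          ≡⟨ ≡.cong (sumList ∘ map wtₘ) (≡.sym (map-trunc-▷ enum)) ⟩
      sumList (map wtₘ (map (_▷ t) L′))            ≡⟨ ≡.cong sumList (≡.sym (map-∘ L′)) ⟩
      sumList (map (λ μ → wtₘ (μ ▷ t)) L′)         ≈⟨ sumList-cong L′ (λ μ → wtₘ-▷ μ t) ⟩
      sumList (map (λ μ → wtₘ μ * tileWt n t) L′)  ≈⟨ sumList-*ʳ wtₘ (tileWt n t) L′ ⟩
      sumList (map wtₘ L′) * tileWt n t            ∎
      where
      t : Tile
      t = β , γ , α
      L′ : List (Mult n)
      L′ = map trunc L

    module Step (k : ℕ) (b*b⁻¹≈1 : B (suc (suc k)) * Binv (suc (suc k)) ≈ 1#) (counts : CountsCovers (suc k))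
                (i : Fin (suc (m 0))) (j : Fin (suc (m (suc (suc k))))) {L : List (Mult (suc (suc k)))}
                (enum : L Enumerates IsCoverₘ (suc (suc k)) (modLab (suc (suc k)) m (toℕ i) (toℕ j))) where

      private
        n M₀ M₁ I J : ℕ
        n = suc k
        M₀ = m n
        M₁ = m (suc n)
        I = toℕ i
        J = toℕ j
        x : ℕ → ℕ
        x = modLab (suc n) m I J

        x-n : x n ≡ M₀
        x-n = modLab-below m I J (ℕₚ.n<1+n n)

        topB : Mult (suc n) → ℕ
        topB μ = proj₁ (top μ)

        fibre : Fin (suc M₀) → List (Mult (suc n))
        fibre q = filter (λ μ → toℕ q ℕ.≟ topB μ) L

      module _ (q : Fin (suc M₀)) where

        private
          Q p : ℕ
          Q = toℕ q
          p = M₀ ∸ Q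
          tile : Tile
          tile = Q , p , M₁ ∸ (p ℕ.+ J)

          fibre-top : ∀ μ → IsCoverₘ (suc n) x μ → Q ≡ topB μ → top μ ≡ tile
          fibre-top μ cov Q≡β = ≡.cong₂ _,_ (≡.sym Q≡β) (≡.cong₂ _,_ γ≡p α≡)
            where
            fits : TileFits x n (top μ)
            fits = top-fits μ cov
            γ≡p : proj₁ (proj₂ (top μ)) ≡ p
            γ≡p = ≡.subst (λ β → proj₁ (proj₂ (top μ)) ≡ M₀ ∸ β) (≡.sym Q≡β)
                          (+≡∸⇒≡∸ {X = M₀} {I = 0} (≡.trans (proj₁ fits) x-n))
            α≡ : proj₂ (proj₂ (top μ)) ≡ M₁ ∸ (p ℕ.+ J)
            α≡ = ≡.trans (+≡∸⇒≡∸ {X = M₁} {I = J} (≡.trans (proj₂ fits) (modLab-top m I J)))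
                         (≡.trans (≡.cong (λ γ → M₁ ∸ (J ℕ.+ γ)) γ≡p) (≡.cong (M₁ ∸_) (ℕₚ.+-comm J p)))

          fibre-enum : fibre q Enumerates IsCoverWithTop n x tile
          fibre-enum = Enumerates-⇔ (Enumerates-filter enum (λ μ → Q ℕ.≟ topB μ)) λ μ → mk⇔
            (λ (cov , Q≡β) → cov , fibre-top μ cov Q≡β)
            (λ (cov , top≡tile) → cov , ≡.cong proj₁ (≡.sym top≡tile))

          fibre-fits : p ℕ.+ J ≤ M₁ → sumList (map wtₘ (fibre q)) ≈ Xₘ n i q * stepMatrix n q j
          fibre-fits p+J≤M₁ = begin
            sumList (map wtₘ (fibre q))                              ≈⟨ fibre-sum fibre-enum ⟩
            sumList (map wtₘ (map trunc (fibre q))) * tileWt n tile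
              ≈⟨ *-congʳ (counts i q (Enumerates-trunc fibre-enum y≡x (modLab-top m I Q) fits)) ⟩
            Xₘ n i q * tileWt n tile
              ≈⟨ *-congˡ (sym (StepMatrix.entry-fits b*b⁻¹≈1 q j p+J≤M₁)) ⟩
            Xₘ n i q * stepMatrix n q j                              ∎
            where
            y≡x : ∀ t → t < n → modLab n m I Q t ≡ x t
            y≡x t t<n = ≡.trans (modLab-below m I Q t<n) (≡.sym (modLab-below m I J (ℕₚ.m<n⇒m<1+n t<n)))
            fits : TileFits x n tile
            fits = ≡.trans (ℕₚ.m+[n∸m]≡n (ℕₚ.≤-pred (toℕ<n q))) (≡.sym x-n) ,
                   ≡.trans (≤⇒+≡∸ {u = p} {I = J} p+J≤M₁) (≡.sym (modLab-top m I J))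

          fibre-¬fits : ¬ (p ℕ.+ J ≤ M₁) → sumList (map wtₘ (fibre q)) ≈ Xₘ n i q * stepMatrix n q j
          fibre-¬fits p+J≰M₁ = begin
            sumList (map wtₘ (fibre q))  ≡⟨ ≡.cong (sumList ∘ map wtₘ) (Enumerates-empty fibre-enum no-cover) ⟩
            0#                           ≈⟨ sym (zeroʳ _) ⟩
            Xₘ n i q * 0#                ≈⟨ *-congˡ (sym (StepMatrix.entry-¬fits b*b⁻¹≈1 q j p+J≰M₁)) ⟩
            Xₘ n i q * stepMatrix n q j  ∎
            where
            no-cover : ∀ μ → ¬ IsCoverWithTop n x tile μ
            no-cover μ (cov , top≡tile) = p+J≰M₁ (+≡∸⇒≤ (ℕₚ.≤-pred (toℕ<n j))
              (≡.trans (proj₂ (≡.subst (TileFits x n) top≡tile (top-fits μ cov))) (modLab-top m I J)))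

        fibre-sum-step : sumList (map wtₘ (fibre q)) ≈ Xₘ n i q * stepMatrix n q j
        fibre-sum-step with p ℕ.+ J ℕ.≤? M₁
        ... | yes p+J≤M₁ = fibre-fits p+J≤M₁
        ... | no  p+J≰M₁ = fibre-¬fits p+J≰M₁

      counts-step : sumList (map wtₘ L) ≈ Xₘ (suc n) i j
      counts-step = begin
        sumList (map wtₘ L)                                ≈⟨ sumList-fibres wtₘ topB M₀ L bounds ⟩
        sumR (suc M₀) (λ q → sumList (map wtₘ (fibre q)))  ≈⟨ sumR-cong (suc M₀) fibre-sum-step ⟩
        Xₘ (suc n) i j                                     ∎
        where
        bounds : All (λ μ → topB μ ≤ M₀) L
        bounds = All.tabulate λ {μ} μ∈L → ≡.subst (topB μ ≤_)
          (≡.trans (proj₁ (top-fits μ (Equivalence.to (proj₂ enum μ) μ∈L))) x-n) (ℕₚ.m≤m+n _ _)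

    module Base (i : Fin (suc (m 0))) (j : Fin (suc (m 1))) {L : List (Mult 1)}
                (enum : L Enumerates IsCoverₘ 1 (modLab 1 m (toℕ i) (toℕ j))) where

      private
        M₀ M₁ I J : ℕ
        M₀ = m 0
        M₁ = m 1
        I = toℕ i
        J = toℕ j
        x : ℕ → ℕ
        x = modLab 1 m I J

        topC : Mult 1 → ℕ
        topC μ = proj₁ (proj₂ (top μ))

        fibre : Fin (suc M₁) → List (Mult 1)
        fibre s = filter (λ μ → toℕ s ℕ.≟ topC μ) L

        UTU-term : Fin (suc M₁) → Carrier
        UTU-term s = (U M₀ (B 1) ⊗ Tm M₀ M₁ (A 0 * C 1)) i s * U M₁ (A 1) s j

      module _ (s : Fin (suc M₁)) where

        private
          S : ℕ
          S = toℕ s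
          tile : Tile
          tile = M₀ ∸ (I ℕ.+ S) , S , M₁ ∸ (S ℕ.+ J)

          fibre-top : ∀ μ → IsCoverₘ 1 x μ → S ≡ topC μ → top μ ≡ tile
          fibre-top μ cov S≡γ = ≡.cong₂ _,_ β≡ (≡.cong₂ _,_ (≡.sym S≡γ) α≡)
            where
            fits : TileFits x 0 (top μ)
            fits = top-fits μ cov
            β≡ : proj₁ (top μ) ≡ M₀ ∸ (I ℕ.+ S)
            β≡ = ≡.trans (+≡∸⇒≡∸ {X = M₀} {I = I} (≡.trans (ℕₚ.+-comm (topC μ) _) (proj₁ fits)))
                         (≡.cong (λ γ → M₀ ∸ (I ℕ.+ γ)) (≡.sym S≡γ))
            α≡ : proj₂ (proj₂ (top μ)) ≡ M₁ ∸ (S ℕ.+ J)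
            α≡ = ≡.trans (+≡∸⇒≡∸ {X = M₁} {I = J} (proj₂ fits))
                         (≡.cong (M₁ ∸_) (≡.trans (ℕₚ.+-comm J (topC μ)) (≡.cong (ℕ._+ J) (≡.sym S≡γ))))

          fibre-enum : fibre s Enumerates IsCoverWithTop 0 x tile
          fibre-enum = Enumerates-⇔ (Enumerates-filter enum (λ μ → S ℕ.≟ topC μ)) λ μ → mk⇔
            (λ (cov , S≡γ) → cov , fibre-top μ cov S≡γ)
            (λ (cov , top≡tile) → cov , ≡.cong (proj₁ ∘ proj₂) (≡.sym top≡tile))

          tileWt-base : pow (A 0) S * tileWt 0 tile ≈
                        pow (B 1) (M₀ ∸ (I ℕ.+ S)) * pow (A 0 * C 1) S * pow (A 1) (M₁ ∸ (S ℕ.+ J))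
          tileWt-base = begin
            pow (A 0) S * (Bβ * Cγ * Aα)  ≈⟨ sym (*-assoc _ _ _) ⟩
            pow (A 0) S * (Bβ * Cγ) * Aα  ≈⟨ *-congʳ (x∙yz≈y∙xz _ _ _) ⟩
            Bβ * (pow (A 0) S * Cγ) * Aα  ≈⟨ *-congʳ (*-congˡ (sym (pow-* (A 0) (C 1) S))) ⟩
            Bβ * pow (A 0 * C 1) S * Aα   ∎
            where
            Bβ Cγ Aα : Carrier
            Bβ = pow (B 1) (M₀ ∸ (I ℕ.+ S))
            Cγ = pow (C 1) S
            Aα = pow (A 1) (M₁ ∸ (S ℕ.+ J))

          fibre-fits : I ℕ.+ S ≤ M₀ → S ℕ.+ J ≤ M₁ → sumList (map wtₘ (fibre s)) ≈ UTU-term s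
          fibre-fits I+S≤M₀ S+J≤M₁ = begin
            sumList (map wtₘ (fibre s))                              ≈⟨ fibre-sum fibre-enum ⟩
            sumList (map wtₘ (map trunc (fibre s))) * tileWt 0 tile
              ≡⟨ ≡.cong (λ K → sumList (map wtₘ K) * tileWt 0 tile) (Enumerates-singleton trunc-enum) ⟩
            (wtₘ (mult (S ∷ []) [] []) + 0#) * tileWt 0 tile
              ≈⟨ *-congʳ (trans (+-identityʳ _) (wtₘ-edge S)) ⟩
            pow (A 0) S * tileWt 0 tile                              ≈⟨ tileWt-base ⟩
            pow (B 1) (M₀ ∸ (I ℕ.+ S)) * pow (A 0 * C 1) S * pow (A 1) (M₁ ∸ (S ℕ.+ J))
              ≈⟨ sym (BaseMatrix.term-fits i j s I+S≤M₀ S+J≤M₁) ⟩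
            UTU-term s                                               ∎
            where
            I+S≡S+I : I ℕ.+ S ≡ S ℕ.+ I
            I+S≡S+I = ℕₚ.+-comm I S
            fits : TileFits x 0 tile
            fits = ≡.trans (ℕₚ.+-comm _ S) (≡.trans (≡.cong (λ z → S ℕ.+ (M₀ ∸ z)) I+S≡S+I)
                                                    (≤⇒+≡∸ {u = S} {I = I} (≡.subst (_≤ M₀) I+S≡S+I I+S≤M₀))) ,
                   ≤⇒+≡∸ {u = S} {I = J} S+J≤M₁
            trunc-enum : map trunc (fibre s) Enumerates (_≡ mult (S ∷ []) [] [])
            trunc-enum = Enumerates-⇔ (Enumerates-trunc fibre-enum {y = λ _ → S} (λ _ ()) ≡.refl fits)
                                      IsCoverₘ-zero

          fibre-¬fits : ¬ (I ℕ.+ S ≤ M₀ × S ℕ.+ J ≤ M₁) → sumList (map wtₘ (fibre s)) ≈ UTU-term s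
          fibre-¬fits ¬fits = begin
            sumList (map wtₘ (fibre s))  ≡⟨ ≡.cong (sumList ∘ map wtₘ) (Enumerates-empty fibre-enum no-cover) ⟩
            0#                           ≈⟨ sym (BaseMatrix.term-¬fits i j s ¬fits) ⟩
            UTU-term s                   ∎
            where
            no-cover : ∀ μ → ¬ IsCoverWithTop 0 x tile μ
            no-cover μ (cov , top≡tile) = ¬fits
              ( ≡.subst (_≤ M₀) (ℕₚ.+-comm S I)
                        (+≡∸⇒≤ (ℕₚ.≤-pred (toℕ<n i)) (≡.trans (ℕₚ.+-comm S _) (proj₁ fits)))
              , +≡∸⇒≤ (ℕₚ.≤-pred (toℕ<n j)) (proj₂ fits))
              where
              fits : TileFits x 0 tile
              fits = ≡.subst (TileFits x 0) top≡tile (top-fits μ cov)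

        fibre-sum-base : sumList (map wtₘ (fibre s)) ≈ UTU-term s
        fibre-sum-base with I ℕ.+ S ℕ.≤? M₀ ×-dec S ℕ.+ J ℕ.≤? M₁
        ... | yes (I+S≤M₀ , S+J≤M₁) = fibre-fits I+S≤M₀ S+J≤M₁
        ... | no  ¬fits             = fibre-¬fits ¬fits

      counts-base : sumList (map wtₘ L) ≈ Xₘ 1 i j
      counts-base = begin
        sumList (map wtₘ L)                                ≈⟨ sumList-fibres wtₘ topC M₁ L bounds ⟩
        sumR (suc M₁) (λ s → sumList (map wtₘ (fibre s)))  ≈⟨ sumR-cong (suc M₁) fibre-sum-base ⟩
        Xₘ 1 i j                                           ∎
        where
        bounds : All (λ μ → topC μ ≤ M₁) L
        bounds = All.tabulate λ {μ} μ∈L → ℕₚ.≤-trans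
          (≡.subst (topC μ ≤_) (proj₂ (top-fits μ (Equivalence.to (proj₂ enum μ) μ∈L))) (ℕₚ.m≤m+n _ _))
          (ℕₚ.m∸n≤m M₁ J)

    countsCovers : ∀ k → (∀ t → 1 ≤ t → t ≤ suc k → B t * Binv t ≈ 1#) → CountsCovers (suc k)
    countsCovers zero    _   i j enum = Base.counts-base i j enum
    countsCovers (suc k) inv i j enum = Step.counts-step k (inv (suc (suc k)) (s≤s z≤n) ℕₚ.≤-refl) counts i j enum
      where
      counts : CountsCovers (suc k)
      counts = countsCovers k (λ t 1≤t t≤1+k → inv t 1≤t (ℕₚ.m≤n⇒m≤1+n t≤1+k))

theorem7 : ∀ {ℓ₁ ℓ₂} (R : CommutativeRing ℓ₁ ℓ₂) →
    let open CommutativeRing R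
        open RingDefs R
    in (n : ℕ) → 1 ≤ n → (m : ℕ → ℕ) → (A B C Binv : ℕ → Carrier) →
       (∀ k → 1 ≤ k → k ≤ n → B k * Binv k ≈ 1#) →
       (i : Fin (suc (m 0))) → (j : Fin (suc (m n))) →
       (L : List (Vec ℕ (E n))) → Unique L →
       (∀ ω → (ω ∈ L) ⇔ IsCover n (label n (modLab n m (toℕ i) (toℕ j))) ω) →
       X m A B C Binv n i j ≈ sumList (map (wt n A B C) L)
theorem7 R (suc k) 1≤n m A B C Binv inv i j L uniq memb = begin
  X m A B C Binv (suc k) i j                  ≈⟨ sym (countsCovers k inv i j covers) ⟩
  sumList (map wtₘ (map (toMult {suc k}) L))  ≈⟨ sym (sumList-toMult {suc k} L) ⟩
  sumList (map (wt (suc k) A B C) L)          ∎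
  where
  open CommutativeRing R
  open RingDefs R
  open Counting R
  open Core m A B C Binv
  open Weights A B C
  open Geometry using (toMult; Enumerates-toMult)
  open Covers using (IsCoverₘ)
  open Enumerations using (_Enumerates_)
  open import Relation.Binary.Reasoning.Setoid setoid
  covers : map (toMult {suc k}) L Enumerates IsCoverₘ (suc k) (modLab (suc k) m (toℕ i) (toℕ j))
  covers = Enumerates-toMult {suc k} 1≤n (uniq , memb)
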